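{- For every positive integer $m$ there exists $n_0=n_0(m)$ such that for all $n\ge n_0$ we have \[ g(n,m)=\prod_{i=0}^{m-1}\left\lfloor\frac{n+i}{m}\right\rfloor=(1+o(1))\left(\frac{n}{m}\right)^m \quad (n\to\infty), \] and the only families $\mathcal{F}\subseteq 2^{[n]}$ with $|\mathcal{F}|=m$ and $|MC(\mathcal{F})|=g(n,m)$ are partitions of $[n]$ into $m$ parts such that $||F|-|F'||\le 1$ for all $F,F'\in\mathcal{F}$.
   Context: Let $[n]=\{1,\dots,n\}$. For a family $\mathcal{F}\subseteq 2^{[n]}$, a set $A\subseteq[n]$ is a cover of $\mathcal{F}$ if $A\cap F\ne\emptyset$ for all $F\in\mathcal{F}$; it is a minimal cover if it is a cover and no proper subset of it is a cover. $MC(\mathcal{F})$ denotes the family of minimal covers of $\mathcal{F}$, and $g(n,m)=\max\{|MC(\mathcal{F})| : \mathcal{F}\subseteq 2^{[n]},\ |\mathcal{F}|=m\}$. -}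

module Defs where

open import Data.Nat using (ℕ; zero; suc; _+_; _*_; _≤_; NonZero)
open import Data.Nat.DivMod using (_/_)
open import Data.Fin using (Fin)
open import Data.Fin.Subset using (Subset; _⊂_; _∩_; _∪_; Nonempty; Empty; ∣_∣; ⊤)
open import Data.List using (List; length)
open import Data.List.Membership.Propositional using () renaming (_∈_ to _∈ₗ_)
open import Data.List.Relation.Unary.Unique.Propositional using (Unique)
open import Data.Product using (Σ; _×_; _,_)
open import Relation.Nullary using (¬_)
open import Relation.Binary.PropositionalEquality using (_≡_; _≢_)

-- A family 𝓕 ⊆ 2^[n] is represented by a duplicate-free list of subsets of
-- [n] = Fin n; its members are the list elements.  |𝓕| = length.
record Family (n : ℕ) : Set where
  constructor family
  field
    sets   : List (Subset n)
    unique : Unique sets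
open Family public

size : ∀ {n} → Family n → ℕ
size 𝓕 = length (sets 𝓕)

IsCover : ∀ {n} → Family n → Subset n → Set
IsCover 𝓕 A = ∀ F → F ∈ₗ sets 𝓕 → Nonempty (A ∩ F)

IsMinCover : ∀ {n} → Family n → Subset n → Set
IsMinCover 𝓕 A = IsCover 𝓕 A × (∀ B → B ⊂ A → ¬ IsCover 𝓕 B)

MCcount : ∀ {n} → Family n → ℕ → Set
MCcount 𝓕 k = Σ (List (Subset _)) λ L →
  Unique L × length L ≡ k × (∀ A → (A ∈ₗ L → IsMinCover 𝓕 A) × (IsMinCover 𝓕 A → A ∈ₗ L))

IsG : ℕ → ℕ → ℕ → Set
IsG n m k =
  (∀ (𝓕 : Family n) → size 𝓕 ≡ m → ∀ c → MCcount 𝓕 c → c ≤ k) ×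
  Σ (Family n) λ 𝓕 → size 𝓕 ≡ m × MCcount 𝓕 k

floorProd : (n m : ℕ) → .{{NonZero m}} → ℕ → ℕ
floorProd n m zero    = 1
floorProd n m (suc j) = floorProd n m j * ((n + j) / m)

IsBalancedPartition : ∀ {n} → Family n → Set
IsBalancedPartition {n} 𝓕 =
  (∀ F → F ∈ₗ sets 𝓕 → Nonempty F) ×
  (∀ F F′ → F ∈ₗ sets 𝓕 → F′ ∈ₗ sets 𝓕 → F ≢ F′ → Empty (F ∩ F′)) ×
  (∀ (x : Fin n) → Σ (Subset n) λ F → F ∈ₗ sets 𝓕 × Data.Fin.Subset._∈_ x F) ×
  (∀ F F′ → F ∈ₗ sets 𝓕 → F′ ∈ₗ sets 𝓕 → ∣ F ∣ ≤ suc ∣ F′ ∣)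

open import Data.Integer using (+_)
open import Data.Rational using (ℚ) renaming (_/_ to _/ℚ_)

ℕ→ℚ : ℕ → ℚ
ℕ→ℚ k = (+ k) /ℚ 1

module Submission where

-- A family 𝓕 of m = k + 1 subsets of [n] has a private part P_F for each member F (the
-- points lying in F only) and a set S of shared points (lying in at least two members),
-- so Σ_F |P_F| + |S| ≤ n. By minimality every point of a minimal cover A is the only point
-- of A in some member. Hence A is determined by a shared point r ∈ A, if there is one,
-- together with a point of A ∩ F for each member F ∌ r, and these points lie in the private
-- parts when A has no shared point: |MC(𝓕)| ≤ Π_F |P_F| + |S| n^(k-1).
-- Among k + 1 numbers with sum σ the product is largest, equal to ∏_i ⌊(σ+i)/(k+1)⌋, exactly
-- when they differ by at most one (move units from large parts to small ones). For large n
-- a point missing from the private parts costs more than n^(k-1), because this balanced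
-- product grows by at least ⌊σ/(k+1)⌋^k when σ grows by one. So |MC(𝓕)| ≤ ∏_i ⌊(n+i)/(k+1)⌋,
-- with equality only if S = ∅ and the private parts are balanced and cover [n], that is,
-- 𝓕 is a balanced partition. The minimal covers of a partition are its transversals, so
-- balanced partitions attain the bound. Finally, every factor satisfies
-- n - k ≤ (k+1) ⌊(n+i)/(k+1)⌋ ≤ n + k, which gives the asymptotics.

module FloorProduct where

  open import Data.Nat
  open import Data.Nat.Properties
  open import Data.Nat.DivMod
  open import Data.Nat.Divisibility using (divides)
  open import Relation.Nullary using (yes; no)
  open import Relation.Binary.PropositionalEquality
  open import Data.Nat.Tactic.RingSolver using (solve-∀)
  open import Defs using (floorProd)

  ^-distribʳ-* : ∀ a b e → (a * b) ^ e ≡ a ^ e * b ^ e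
  ^-distribʳ-* a b zero = refl
  ^-distribʳ-* a b (suc e) = trans (cong (a * b *_) (^-distribʳ-* a b e)) (interchange a b (a ^ e) (b ^ e))
    where
    interchange : ∀ a b x y → a * b * (x * y) ≡ a * x * (b * y)
    interchange = solve-∀

  [q*m+r]/m≡q : ∀ q {m r} .{{_ : NonZero m}} → r < m → (q * m + r) / m ≡ q
  [q*m+r]/m≡q q {m} {r} r<m = begin
    (q * m + r) / m   ≡⟨ +-distrib-/-∣ˡ r (divides q refl) ⟩
    q * m / m + r / m ≡⟨ cong₂ _+_ (m*n/n≡m q m) (m<n⇒m/n≡0 r<m) ⟩
    q + 0             ≡⟨ +-identityʳ q ⟩
    q                 ∎
    where open ≡-Reasoning

  module _ (m : ℕ) .{{_ : NonZero m}} where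

    floorProd-+ : ∀ σ a c → floorProd σ m (a + c) ≡ floorProd σ m a * floorProd (σ + a) m c
    floorProd-+ σ a zero = begin
      floorProd σ m (a + 0) ≡⟨ cong (floorProd σ m) (+-identityʳ a) ⟩
      floorProd σ m a       ≡⟨ *-identityʳ _ ⟨
      floorProd σ m a * 1   ∎
      where open ≡-Reasoning
    floorProd-+ σ a (suc c) = begin
      floorProd σ m (a + suc c)                                   ≡⟨ cong (floorProd σ m) (+-suc a c) ⟩
      floorProd σ m (a + c) * ((σ + (a + c)) / m)                 ≡⟨ cong₂ _*_ (floorProd-+ σ a c) (/-congˡ (sym (+-assoc σ a c))) ⟩
      floorProd σ m a * floorProd (σ + a) m c * ((σ + a + c) / m) ≡⟨ *-assoc (floorProd σ m a) _ _ ⟩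
      floorProd σ m a * floorProd (σ + a) m (suc c)               ∎
      where open ≡-Reasoning

    floorProd-const : ∀ σ q j → (∀ i → i < j → (σ + i) / m ≡ q) → floorProd σ m j ≡ q ^ j
    floorProd-const σ q zero _ = refl
    floorProd-const σ q (suc j) h = begin
      floorProd σ m j * ((σ + j) / m) ≡⟨ cong₂ _*_ (floorProd-const σ q j (λ i i<j → h i (m<n⇒m<1+n i<j))) (h j ≤-refl) ⟩
      q ^ j * q                       ≡⟨ *-comm (q ^ j) q ⟩
      q ^ suc j                       ∎
      where open ≡-Reasoning

    pow≤floorProd : ∀ σ q j → (∀ i → i < j → q ≤ (σ + i) / m) → q ^ j ≤ floorProd σ m j
    pow≤floorProd σ q zero _ = ≤-refl
    pow≤floorProd σ q (suc j) h = begin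
      q * q ^ j                       ≡⟨ *-comm q (q ^ j) ⟩
      q ^ j * q                       ≤⟨ *-mono-≤ (pow≤floorProd σ q j (λ i i<j → h i (m<n⇒m<1+n i<j))) (h j ≤-refl) ⟩
      floorProd σ m j * ((σ + j) / m) ∎
      where open ≤-Reasoning

  -- The numbers ⌊(σ + i)/(k + 1)⌋, i ≤ k, are the part sizes of the balanced partition of σ into k + 1 parts.
  balancedProduct : ℕ → ℕ → ℕ
  balancedProduct k σ = floorProd σ (suc k) (suc k)

  module _ (k : ℕ) where

    private
      m : ℕ
      m = suc k

    balancedProduct-divMod : ∀ q {b} → b ≤ k → balancedProduct k (q * m + b) ≡ q ^ (m ∸ b) * suc q ^ b
    balancedProduct-divMod q {b} b≤k = begin
      floorProd σ m m                           ≡⟨ cong (floorProd σ m) (m∸n+n≡m b≤m) ⟨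
      floorProd σ m (m ∸ b + b)                 ≡⟨ floorProd-+ m σ (m ∸ b) b ⟩
      floorProd σ m (m ∸ b) * floorProd (σ + (m ∸ b)) m b
        ≡⟨ cong₂ _*_ (floorProd-const m σ q (m ∸ b) low) (floorProd-const m (σ + (m ∸ b)) (suc q) b high) ⟩
      q ^ (m ∸ b) * suc q ^ b                   ∎
      where
      open ≡-Reasoning
      σ : ℕ
      σ = q * m + b
      b≤m : b ≤ m
      b≤m = m≤n⇒m≤1+n b≤k
      low : ∀ i → i < m ∸ b → (σ + i) / m ≡ q
      low i i<m∸b = begin
        (q * m + b + i) / m   ≡⟨ /-congˡ (+-assoc (q * m) b i) ⟩
        (q * m + (b + i)) / m ≡⟨ [q*m+r]/m≡q q (subst (b + i <_) (m+[n∸m]≡n b≤m) (+-monoʳ-< b i<m∸b)) ⟩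
        q                     ∎
      high : ∀ i → i < b → (σ + (m ∸ b) + i) / m ≡ suc q
      high i i<b = begin
        (q * m + b + (m ∸ b) + i) / m ≡⟨ /-congˡ (cong (_+ i) (trans (+-assoc (q * m) b (m ∸ b)) (cong (q * m +_) (m+[n∸m]≡n b≤m)))) ⟩
        (q * m + m + i) / m           ≡⟨ /-congˡ (cong (_+ i) (+-comm (q * m) m)) ⟩
        (suc q * m + i) / m           ≡⟨ [q*m+r]/m≡q (suc q) (≤-trans i<b (m≤n⇒m≤1+n b≤k)) ⟩
        suc q                         ∎

    -- Dropping the first factor ⌊σ/m⌋ and appending ⌊(σ+m)/m⌋ = ⌊σ/m⌋ + 1 turns
    -- the product for σ into the one for σ + 1; the factors in between form the gain.
    balancedProduct-gain : ℕ → ℕ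
    balancedProduct-gain σ = floorProd (suc σ) m k

    balancedProduct≡quot*gain : ∀ σ → balancedProduct k σ ≡ σ / m * balancedProduct-gain σ
    balancedProduct≡quot*gain σ = begin
      floorProd σ m (1 + k)                       ≡⟨ floorProd-+ m σ 1 k ⟩
      1 * ((σ + 0) / m) * floorProd (σ + 1) m k
        ≡⟨ cong₂ _*_ (trans (*-identityˡ _) (/-congˡ (+-identityʳ σ))) (cong (λ τ → floorProd τ m k) (+-comm σ 1)) ⟩
      σ / m * floorProd (suc σ) m k               ∎
      where open ≡-Reasoning

    balancedProduct-suc : ∀ σ → balancedProduct k (suc σ) ≡ balancedProduct k σ + balancedProduct-gain σ
    balancedProduct-suc σ = begin
      floorProd (suc σ) m k * ((suc σ + k) / m) ≡⟨ cong (G *_) last ⟩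
      G * suc (σ / m)                           ≡⟨ *-suc G (σ / m) ⟩
      G + G * (σ / m)                           ≡⟨ +-comm G _ ⟩
      G * (σ / m) + G                           ≡⟨ cong (_+ G) (trans (*-comm G (σ / m)) (sym (balancedProduct≡quot*gain σ))) ⟩
      balancedProduct k σ + G                   ∎
      where
      open ≡-Reasoning
      G : ℕ
      G = balancedProduct-gain σ
      last : (suc σ + k) / m ≡ suc (σ / m)
      last = begin
        (suc σ + k) / m  ≡⟨ /-congˡ (trans (sym (+-suc σ k)) (cong (σ +_) (sym (*-identityˡ m)))) ⟩
        (σ + 1 * m) / m  ≡⟨ +-distrib-/-∣ʳ σ (divides 1 refl) ⟩
        σ / m + 1 * m / m ≡⟨ cong (σ / m +_) (m*n/n≡m 1 m) ⟩
        σ / m + 1        ≡⟨ +-comm (σ / m) 1 ⟩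
        suc (σ / m)      ∎

    pow≤gain : ∀ {q σ} → q * m ≤ σ → q ^ k ≤ balancedProduct-gain σ
    pow≤gain {q} {σ} qm≤σ = pow≤floorProd m (suc σ) q k λ i _ →
      subst (_≤ (suc σ + i) / m) (m*n/n≡m q m) (/-monoˡ-≤ m (≤-trans qm≤σ (≤-trans (n≤1+n σ) (m≤m+n (suc σ) i))))

    1≤gain : ∀ {σ} → m ≤ σ → 1 ≤ balancedProduct-gain σ
    1≤gain {σ} m≤σ = subst (_≤ balancedProduct-gain σ) (^-zeroˡ k) (pow≤gain (subst (_≤ σ) (sym (*-identityˡ m)) m≤σ))

    balancedProduct-mono-≤ : ∀ {σ τ} → σ ≤ τ → balancedProduct k σ ≤ balancedProduct k τ
    balancedProduct-mono-≤ {σ} {τ} σ≤τ with ≤⇒≤′ σ≤τ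
    ... | ≤′-refl = ≤-refl
    ... | ≤′-step {n = τ′} σ≤′τ′ = begin
      balancedProduct k σ                            ≤⟨ balancedProduct-mono-≤ (≤′⇒≤ σ≤′τ′) ⟩
      balancedProduct k τ′                           ≤⟨ m≤m+n _ _ ⟩
      balancedProduct k τ′ + balancedProduct-gain τ′ ≡⟨ balancedProduct-suc τ′ ⟨
      balancedProduct k (suc τ′)                     ∎
      where open ≤-Reasoning

    balancedProduct-pos : ∀ {n} → m ≤ n → 1 ≤ balancedProduct k n
    balancedProduct-pos {n} m≤n = begin
      1 * 1                          ≤⟨ *-mono-≤ (m≥n⇒m/n>0 m≤n) (1≤gain m≤n) ⟩
      n / m * balancedProduct-gain n ≡⟨ balancedProduct≡quot*gain n ⟨
      balancedProduct k n            ∎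
      where open ≤-Reasoning

    balancedProduct-mono-< : ∀ {σ n} → m ≤ n → σ < n → balancedProduct k σ < balancedProduct k n
    balancedProduct-mono-< {σ} {n} m≤n σ<n with m ≤? σ
    ... | yes m≤σ = begin-strict
      balancedProduct k σ                          ≡⟨ +-identityʳ _ ⟨
      balancedProduct k σ + 0                      <⟨ +-monoʳ-< (balancedProduct k σ) (1≤gain m≤σ) ⟩
      balancedProduct k σ + balancedProduct-gain σ ≡⟨ balancedProduct-suc σ ⟨
      balancedProduct k (suc σ)                    ≤⟨ balancedProduct-mono-≤ σ<n ⟩
      balancedProduct k n                          ∎
      where open ≤-Reasoning
    ... | no m≰σ = begin-strict
      balancedProduct k σ            ≡⟨ balancedProduct≡quot*gain σ ⟩
      σ / m * balancedProduct-gain σ ≡⟨ cong (_* balancedProduct-gain σ) (m<n⇒m/n≡0 (≰⇒> m≰σ)) ⟩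
      0                              <⟨ balancedProduct-pos m≤n ⟩
      balancedProduct k n            ∎
      where open ≤-Reasoning

module Lists where

  open import Data.Nat using (suc; _+_; _*_; _≤_; z≤n; s≤s)
  open import Data.Nat.Properties using (≤-trans; ≤-reflexive; n≤1+n; +-mono-≤)
  open import Data.Nat.ListAction using (product)
  open import Data.List using (List; []; _∷_; [_]; _++_; length; map; concatMap; cartesianProductWith)
  open import Data.List.Properties using (length-++; length-map; ∷-injective; map-cong-local)
  open import Data.List.Membership.Propositional using (_∈_)
  open import Data.List.Membership.Propositional.Properties
    using (∈-∃++; ∈-cartesianProductWith⁺; ∈-cartesianProductWith⁻; ∈-length)
  open import Data.List.Relation.Unary.Any using (here; there)
  open import Data.List.Relation.Unary.All as All using (All; []; _∷_)
  import Data.List.Relation.Unary.All.Properties as All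
  open import Data.List.Relation.Unary.AllPairs using (AllPairs; []; _∷_)
  open import Data.List.Relation.Unary.Unique.Propositional using (Unique)
  import Data.List.Relation.Unary.Unique.Propositional.Properties as Unique
  open import Data.List.Relation.Binary.Permutation.Propositional using (_↭_; ↭-prep; ↭-trans)
  open import Data.List.Relation.Binary.Permutation.Propositional.Properties using (shift; ∈-resp-↭; ↭-length)
  open import Data.Product using (Σ; ∃; _×_; _,_)
  open import Data.Empty using (⊥-elim)
  open import Relation.Binary.Definitions using (DecidableEquality)
  open import Relation.Nullary using (yes; no)
  open import Relation.Binary.PropositionalEquality hiding ([_])

  module _ {A : Set} where

    ∈⇒↭∷ : ∀ {x : A} {xs} → x ∈ xs → ∃ λ ys → xs ↭ x ∷ ys
    ∈⇒↭∷ x∈xs with ys , zs , refl ← ∈-∃++ x∈xs = ys ++ zs , shift _ ys zs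

    ∈∈≢⇒↭∷∷ : ∀ {x y : A} {xs} → x ∈ xs → y ∈ xs → x ≢ y → ∃ λ zs → xs ↭ x ∷ y ∷ zs
    ∈∈≢⇒↭∷∷ x∈xs y∈xs x≢y with ys , xs↭x∷ys ← ∈⇒↭∷ x∈xs with ∈-resp-↭ xs↭x∷ys y∈xs
    ... | here y≡x = ⊥-elim (x≢y (sym y≡x))
    ... | there y∈ys with zs , ys↭y∷zs ← ∈⇒↭∷ y∈ys = zs , ↭-trans xs↭x∷ys (↭-prep _ ys↭y∷zs)

    Unique⇒length≤ : ∀ {xs ys : List A} → Unique xs → (∀ {x} → x ∈ xs → x ∈ ys) → length xs ≤ length ys
    Unique⇒length≤ {[]} _ _ = z≤n
    Unique⇒length≤ {x ∷ xs} (x∉xs ∷ xs!) xs⊆ys with ys′ , ys↭x∷ys′ ← ∈⇒↭∷ (xs⊆ys (here refl)) =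
      ≤-trans (s≤s (Unique⇒length≤ xs! xs⊆ys′)) (≤-reflexive (sym (↭-length ys↭x∷ys′)))
      where
      xs⊆ys′ : ∀ {z} → z ∈ xs → z ∈ ys′
      xs⊆ys′ z∈xs with ∈-resp-↭ ys↭x∷ys′ (xs⊆ys (there z∈xs))
      ... | here z≡x = ⊥-elim (All.lookup x∉xs z∈xs (sym z≡x))
      ... | there z∈ys′ = z∈ys′

    ∈∈≢⇒2≤length : ∀ {x y : A} {xs} → x ∈ xs → y ∈ xs → x ≢ y → 2 ≤ length xs
    ∈∈≢⇒2≤length (here refl) (here refl) x≢y = ⊥-elim (x≢y refl)
    ∈∈≢⇒2≤length (here refl) (there y∈xs) _ = s≤s (∈-length y∈xs)
    ∈∈≢⇒2≤length (there x∈xs) (here refl) _ = s≤s (∈-length x∈xs)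
    ∈∈≢⇒2≤length (there x∈xs) (there y∈xs) x≢y = ≤-trans (∈∈≢⇒2≤length x∈xs y∈xs x≢y) (n≤1+n _)

    Unique∧all-equal⇒length≤1 : ∀ {xs : List A} → Unique xs → (∀ {x y} → x ∈ xs → y ∈ xs → x ≡ y) → length xs ≤ 1
    Unique∧all-equal⇒length≤1 [] _ = z≤n
    Unique∧all-equal⇒length≤1 (_ ∷ []) _ = s≤s z≤n
    Unique∧all-equal⇒length≤1 ((x≢y ∷ _) ∷ _) all-equal = ⊥-elim (x≢y (all-equal (here refl) (there (here refl))))

    map-Unique : ∀ {B : Set} (f : A → B) {xs} → Unique xs →
      (∀ {x y} → x ∈ xs → y ∈ xs → f x ≡ f y → x ≡ y) → Unique (map f xs)
    map-Unique f [] _ = []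
    map-Unique f {x ∷ xs} (x∉xs ∷ xs!) f-inj =
      All.map⁺ (All.tabulate (λ y∈xs fx≡fy → All.lookup x∉xs y∈xs (f-inj (here refl) (there y∈xs) fx≡fy)))
      ∷ map-Unique f xs! (λ x∈ y∈ → f-inj (there x∈) (there y∈))

    map-AllPairs : ∀ {B : Set} {R : B → B → Set} (f : A → B) {xs} → Unique xs →
      (∀ {x y} → x ∈ xs → y ∈ xs → x ≢ y → R (f x) (f y)) → AllPairs R (map f xs)
    map-AllPairs f [] _ = []
    map-AllPairs f {x ∷ xs} (x∉xs ∷ xs!) R-f =
      All.map⁺ (All.tabulate (λ y∈xs → R-f (here refl) (there y∈xs) (All.lookup x∉xs y∈xs)))
      ∷ map-AllPairs f xs! (λ x∈ y∈ → R-f (there x∈) (there y∈))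

    length-concatMap≤ : ∀ {B : Set} (f : A → List B) {b} xs → (∀ {x} → x ∈ xs → length (f x) ≤ b) →
      length (concatMap f xs) ≤ length xs * b
    length-concatMap≤ f [] _ = z≤n
    length-concatMap≤ f (x ∷ xs) f≤b = ≤-trans (≤-reflexive (length-++ (f x)))
      (+-mono-≤ (f≤b (here refl)) (length-concatMap≤ f xs (λ x∈ → f≤b (there x∈))))

    choices : List (List A) → List (List A)
    choices [] = [ [] ]
    choices (xs ∷ xss) = cartesianProductWith _∷_ xs (choices xss)

    length-choices : ∀ xss → length (choices xss) ≡ product (map length xss)
    length-choices [] = refl
    length-choices (xs ∷ xss) = trans (length-cartesian xs) (cong (length xs *_) (length-choices xss))
      where
      length-cartesian : ∀ ys → length (cartesianProductWith _∷_ ys (choices xss)) ≡ length ys * length (choices xss)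
      length-cartesian [] = refl
      length-cartesian (y ∷ ys) = trans (length-++ (map (y ∷_) (choices xss)))
        (cong₂ _+_ (length-map (y ∷_) (choices xss)) (length-cartesian ys))

    choices-Unique : ∀ {xss} → All Unique xss → Unique (choices xss)
    choices-Unique [] = [] ∷ []
    choices-Unique (xs! ∷ xss!) = Unique.cartesianProductWith⁺ _∷_ ∷-injective xs! (choices-Unique xss!)

    module _ {I : Set} where

      ∈-choices⁺ : ∀ (is : List I) (pick : I → A) (options : I → List A) →
        (∀ {i} → i ∈ is → pick i ∈ options i) → map pick is ∈ choices (map options is)
      ∈-choices⁺ [] pick options _ = here refl
      ∈-choices⁺ (i ∷ is) pick options pick∈ =
        ∈-cartesianProductWith⁺ _∷_ (pick∈ (here refl)) (∈-choices⁺ is pick options (λ j∈ → pick∈ (there j∈)))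

      -- a₀ is the junk value of the choice function outside the index list.
      ∈-choices⁻ : A → DecidableEquality I → ∀ (options : I → List A) {is vs} → Unique is →
        vs ∈ choices (map options is) → Σ (I → A) λ pick → vs ≡ map pick is × (∀ {i} → i ∈ is → pick i ∈ options i)
      ∈-choices⁻ a₀ _≟_ options {[]} _ (here refl) = (λ _ → a₀) , refl , λ ()
      ∈-choices⁻ a₀ _≟_ options {i ∷ is} (i∉is ∷ is!) vs∈
        with a , ws , a∈ , ws∈ , refl ← ∈-cartesianProductWith⁻ _∷_ (options i) (choices (map options is)) vs∈
        with pick , refl , pick∈ ← ∈-choices⁻ a₀ _≟_ options is! ws∈
        = pick′ , cong₂ _∷_ (sym pick′-i) (map-cong-local (All.tabulate (λ j∈ → sym (pick′≡pick j∈)))) , pick′∈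
        where
        pick′ : I → A
        pick′ j with j ≟ i
        ... | yes _ = a
        ... | no _ = pick j
        pick′-i : pick′ i ≡ a
        pick′-i with i ≟ i
        ... | yes _ = refl
        ... | no i≢i = ⊥-elim (i≢i refl)
        pick′≡pick : ∀ {j} → j ∈ is → pick′ j ≡ pick j
        pick′≡pick {j} j∈is with j ≟ i
        ... | yes refl = ⊥-elim (All.lookup i∉is j∈is refl)
        ... | no _ = refl
        pick′∈ : ∀ {j} → j ∈ i ∷ is → pick′ j ∈ options j
        pick′∈ (here refl) = subst (_∈ options i) (sym pick′-i) a∈
        pick′∈ {j} (there j∈is) = subst (_∈ options j) (sym (pick′≡pick j∈is)) (pick∈ j∈is)

module ProductBound where

  open import Data.Nat
  open import Data.Nat.Properties
  open import Data.Nat.ListAction using (sum; product)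
  open import Data.Nat.ListAction.Properties using (sum-↭; product-↭)
  open import Data.List using (List; []; _∷_; length; map)
  open import Data.List.Membership.Propositional using (_∈_)
  open import Data.List.Relation.Unary.Any using (here; there)
  import Data.List.Relation.Unary.All as All
  open import Data.List.Relation.Binary.Permutation.Propositional using (_↭_)
  open import Data.List.Relation.Binary.Permutation.Propositional.Properties using (↭-length; map⁺)
  open import Data.List.Extrema.Nat using (min; max; argmin-sel; argmax-sel; min≤⊤; min≤xs; ⊥≤max; xs≤max)
  open import Data.Product using (∃₂; _×_; _,_)
  open import Data.Sum using (_⊎_; inj₁; inj₂)
  open import Data.Empty using (⊥-elim)
  open import Function using (id)
  open import Relation.Nullary using (yes; no)
  open import Relation.Binary.PropositionalEquality
  open import Data.Nat.Tactic.RingSolver using (solve-∀)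
  open FloorProduct
  open Lists using (∈∈≢⇒↭∷∷)

  Balanced : List ℕ → Set
  Balanced xs = ∀ {a c} → a ∈ xs → c ∈ xs → a ≤ suc c

  Unbalanced : List ℕ → Set
  Unbalanced xs = ∃₂ λ a c → a ∈ xs × c ∈ xs × 2 + c ≤ a

  min∈ : ∀ x xs → min x xs ∈ x ∷ xs
  min∈ x xs with argmin-sel id x xs
  ... | inj₁ min≡x = here min≡x
  ... | inj₂ min∈xs = there min∈xs

  min≤ : ∀ {x xs z} → z ∈ x ∷ xs → min x xs ≤ z
  min≤ {x} {xs} (here refl) = min≤⊤ x xs
  min≤ {x} {xs} (there z∈xs) = All.lookup (min≤xs x xs) z∈xs

  max∈ : ∀ x xs → max x xs ∈ x ∷ xs
  max∈ x xs with argmax-sel id x xs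
  ... | inj₁ max≡x = here max≡x
  ... | inj₂ max∈xs = there max∈xs

  ≤max : ∀ {x xs z} → z ∈ x ∷ xs → z ≤ max x xs
  ≤max {x} {xs} (here refl) = ⊥≤max x xs
  ≤max {x} {xs} (there z∈xs) = All.lookup (xs≤max x xs) z∈xs

  balanced? : ∀ xs → Balanced xs ⊎ Unbalanced xs
  balanced? [] = inj₁ λ ()
  balanced? (x ∷ xs) with max x xs ≤? suc (min x xs)
  ... | yes max≤1+min = inj₁ λ a∈ c∈ → ≤-trans (≤max a∈) (≤-trans max≤1+min (s≤s (min≤ c∈)))
  ... | no max≰1+min = inj₂ (max x xs , min x xs , max∈ x xs , min∈ x xs , ≰⇒> max≰1+min)

  twoValued⇒Balanced : ∀ {q xs} → (∀ {z} → z ∈ xs → z ≡ q ⊎ z ≡ suc q) → Balanced xs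
  twoValued⇒Balanced {q} two a∈ c∈ = ≤-trans (≤1+q (two a∈)) (s≤s (q≤ (two c∈)))
    where
    ≤1+q : ∀ {z} → z ≡ q ⊎ z ≡ suc q → z ≤ suc q
    ≤1+q (inj₁ refl) = n≤1+n q
    ≤1+q (inj₂ refl) = ≤-refl
    q≤ : ∀ {z} → z ≡ q ⊎ z ≡ suc q → q ≤ z
    q≤ (inj₁ refl) = ≤-refl
    q≤ (inj₂ refl) = n≤1+n q

  record TwoValued (q : ℕ) (xs : List ℕ) : Set where
    field
      low high  : ℕ
      length≡   : low + high ≡ length xs
      product≡  : product xs ≡ q ^ low * suc q ^ high
      sum≡      : sum xs ≡ q * (low + high) + high
      low-pos   : q ∈ xs → 1 ≤ low

  twoValued : ∀ q xs → (∀ {z} → z ∈ xs → z ≡ q ⊎ z ≡ suc q) → TwoValued q xs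
  twoValued q [] _ = record
    { low = 0 ; high = 0 ; length≡ = refl ; product≡ = refl
    ; sum≡ = sym (trans (+-identityʳ (q * 0)) (*-zeroʳ q)) ; low-pos = λ () }
  twoValued q (x ∷ xs) two with twoValued q xs (λ z∈xs → two (there z∈xs)) | two (here refl)
  ... | T | inj₁ refl = record
    { low = suc low ; high = high ; length≡ = cong suc length≡
    ; product≡ = trans (cong (q *_) product≡) (sym (*-assoc q (q ^ low) (suc q ^ high)))
    ; sum≡ = trans (cong (q +_) sum≡) (sum-helper q (low + high) high)
    ; low-pos = λ _ → s≤s z≤n }
    where
    open TwoValued T
    sum-helper : ∀ q s h → q + (q * s + h) ≡ q * suc s + h
    sum-helper = solve-∀
  ... | T | inj₂ refl = record
    { low = low ; high = suc high ; length≡ = trans (+-suc low high) (cong suc length≡)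
    ; product≡ = trans (cong (suc q *_) product≡) (left-commute (suc q) (q ^ low) (suc q ^ high))
    ; sum≡ = trans (cong (suc q +_) sum≡) (trans (sum-helper q (low + high) high) (cong (λ s → q * s + suc high) (sym (+-suc low high))))
    ; low-pos = λ { (here q≡1+q) → ⊥-elim (<-irrefl q≡1+q (n<1+n q)) ; (there q∈xs) → low-pos q∈xs } }
    where
    open TwoValued T
    left-commute : ∀ s x y → s * (x * y) ≡ x * (s * y)
    left-commute = solve-∀
    sum-helper : ∀ q s h → suc q + (q * s + h) ≡ q * suc s + suc h
    sum-helper = solve-∀

  product-balanced : ∀ k xs → length xs ≡ suc k → Balanced xs → product xs ≡ balancedProduct k (sum xs)
  product-balanced k (x ∷ xs) length≡1+k bal = begin
    product (x ∷ xs)                         ≡⟨ product≡ ⟩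
    q ^ low * suc q ^ high                   ≡⟨ cong (λ e → q ^ e * suc q ^ high) low≡ ⟩
    q ^ (suc k ∸ high) * suc q ^ high        ≡⟨ balancedProduct-divMod k q high≤k ⟨
    balancedProduct k (q * suc k + high)     ≡⟨ cong (λ s → balancedProduct k (q * s + high)) low+high≡1+k ⟨
    balancedProduct k (q * (low + high) + high) ≡⟨ cong (balancedProduct k) sum≡ ⟨
    balancedProduct k (sum (x ∷ xs))         ∎
    where
    open ≡-Reasoning
    q : ℕ
    q = min x xs
    q-or-suc-q : ∀ {z} → z ∈ x ∷ xs → z ≡ q ⊎ z ≡ suc q
    q-or-suc-q z∈ with m≤n⇒m<n∨m≡n (min≤ z∈)
    ... | inj₂ q≡z = inj₁ (sym q≡z)
    ... | inj₁ q<z = inj₂ (≤-antisym (bal z∈ (min∈ x xs)) q<z)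
    open TwoValued (twoValued q (x ∷ xs) q-or-suc-q)
    low+high≡1+k : low + high ≡ suc k
    low+high≡1+k = trans length≡ length≡1+k
    high≤k : high ≤ k
    high≤k = s≤s⁻¹ (≤-trans (+-monoˡ-≤ high (low-pos (min∈ x xs))) (≤-reflexive low+high≡1+k))
    low≡ : low ≡ suc k ∸ high
    low≡ = trans (sym (m+n∸n≡m low high)) (cong (_∸ high) low+high≡1+k)

  sumSq : List ℕ → ℕ
  sumSq xs = sum (map (λ x → x * x) xs)

  -- ys moves one unit from an entry a of xs to an entry c ≤ a − 2.
  record Smoothing (xs : List ℕ) : Set where
    field
      ys        : List ℕ
      length-≡  : length ys ≡ length xs
      sum-≡     : sum ys ≡ sum xs
      sumSq-<   : sumSq ys < sumSq xs
      product-≤ : product xs ≤ product ys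
      product-< : 1 ≤ product xs → product xs < product ys

  smoothing : ∀ {xs} → Unbalanced xs → Smoothing xs
  smoothing {xs} (_ , c , a∈xs , c∈xs , 2+c≤a)
    with d , refl ← m≤n⇒∃[o]m+o≡n 2+c≤a
    with zs , xs↭ ← ∈∈≢⇒↭∷∷ a∈xs c∈xs (λ a≡c → <-irrefl (sym a≡c) (≤-trans (n≤1+n (suc c)) 2+c≤a)) = record
    { ys = ys
    ; length-≡ = sym (↭-length xs↭)
    ; sum-≡ = begin-equality
        sum ys                  ≡⟨ sum-identity c d (sum zs) ⟩
        sum (a ∷ c ∷ zs)        ≡⟨ sum-↭ xs↭ ⟨
        sum xs                  ∎
    ; sumSq-< = begin-strict
        sumSq ys                <⟨ m<m+n (sumSq ys) z<s ⟩
        sumSq ys + (2 + 2 * d)  ≡⟨ sumSq-identity c d (sumSq zs) ⟨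
        sumSq (a ∷ c ∷ zs)      ≡⟨ sum-↭ (map⁺ (λ x → x * x) xs↭) ⟨
        sumSq xs                ∎
    ; product-≤ = ≤-trans (m≤m+n (product xs) _) (≤-reflexive (sym product-ys))
    ; product-< = λ 1≤Πxs → begin-strict
        product xs                      <⟨ m<m+n (product xs) (≤-trans (s≤s z≤n) (*-monoʳ-≤ (suc d) (rest-pos 1≤Πxs))) ⟩
        product xs + suc d * product zs ≡⟨ product-ys ⟨
        product ys                      ∎
    }
    where
    open ≤-Reasoning
    a : ℕ
    a = 2 + c + d
    ys : List ℕ
    ys = suc (c + d) ∷ suc c ∷ zs
    sum-identity : ∀ c d s → suc (c + d) + (suc c + s) ≡ (2 + c + d) + (c + s)
    sum-identity = solve-∀
    sumSq-identity : ∀ c d s → (2 + c + d) * (2 + c + d) + (c * c + s) ≡ suc (c + d) * suc (c + d) + (suc c * suc c + s) + (2 + 2 * d)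
    sumSq-identity = solve-∀
    product-identity : ∀ c d p → suc (c + d) * (suc c * p) ≡ (2 + c + d) * (c * p) + suc d * p
    product-identity = solve-∀
    product-ys : product ys ≡ product xs + suc d * product zs
    product-ys = trans (product-identity c d (product zs)) (cong (_+ suc d * product zs) (sym (product-↭ xs↭)))
    rest-pos : 1 ≤ product xs → 1 ≤ product zs
    rest-pos 1≤Πxs = n≢0⇒n>0 λ Πzs≡0 → <⇒≢ 1≤Πxs (sym (begin-equality
      product xs           ≡⟨ product-↭ xs↭ ⟩
      a * (c * product zs) ≡⟨ cong (λ p → a * (c * p)) Πzs≡0 ⟩
      a * (c * 0)          ≡⟨ cong (a *_) (*-zeroʳ c) ⟩
      a * 0                ≡⟨ *-zeroʳ a ⟩
      0                    ∎))

  product≤balancedProduct : ∀ k xs → length xs ≡ suc k → product xs ≤ balancedProduct k (sum xs)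
  product≤balancedProduct k xs = bySumSq (suc (sumSq xs)) xs ≤-refl
    where
    bySumSq : ∀ s xs → sumSq xs < s → length xs ≡ suc k → product xs ≤ balancedProduct k (sum xs)
    bySumSq (suc s) xs sumSq<s length≡ with balanced? xs
    ... | inj₁ bal = ≤-reflexive (product-balanced k xs length≡ bal)
    ... | inj₂ unbal = begin
      product xs                  ≤⟨ product-≤ ⟩
      product ys                  ≤⟨ bySumSq s ys (≤-trans sumSq-< (s≤s⁻¹ sumSq<s)) (trans length-≡ length≡) ⟩
      balancedProduct k (sum ys)  ≡⟨ cong (balancedProduct k) sum-≡ ⟩
      balancedProduct k (sum xs)  ∎
      where
      open ≤-Reasoning
      open Smoothing (smoothing unbal)

  product≡balancedProduct⇒Balanced : ∀ k xs → length xs ≡ suc k → 1 ≤ product xs →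
    product xs ≡ balancedProduct k (sum xs) → Balanced xs
  product≡balancedProduct⇒Balanced k xs length≡ 1≤Πxs Πxs≡ with balanced? xs
  ... | inj₁ bal = bal
  ... | inj₂ unbal = ⊥-elim (<-irrefl Πxs≡ (begin-strict
      product xs                 <⟨ product-< 1≤Πxs ⟩
      product ys                 ≤⟨ product≤balancedProduct k ys (trans length-≡ length≡) ⟩
      balancedProduct k (sum ys) ≡⟨ cong (balancedProduct k) sum-≡ ⟩
      balancedProduct k (sum xs) ∎))
    where
    open ≤-Reasoning
    open Smoothing (smoothing unbal)

  1≤product⇒1≤∈ : ∀ {xs x} → 1 ≤ product xs → x ∈ xs → 1 ≤ x
  1≤product⇒1≤∈ {x ∷ xs} 1≤Π (here refl) = n≢0⇒n>0 λ x≡0 → <⇒≢ 1≤Π (sym (trans (cong (_* product xs) x≡0) refl))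
  1≤product⇒1≤∈ {y ∷ xs} 1≤Π (there x∈xs) =
    1≤product⇒1≤∈ (n≢0⇒n>0 λ Π≡0 → <⇒≢ 1≤Π (sym (trans (cong (y *_) Π≡0) (*-zeroʳ y)))) x∈xs

module Deficit where

  open import Data.Nat
  open import Data.Nat.Properties
  open import Data.Nat.DivMod
  open import Data.Nat.ListAction using (sum; product)
  open import Data.List using (List; length)
  open import Data.Product using (∃; _×_; _,_)
  open import Data.Sum using (_⊎_; inj₁; inj₂)
  open import Data.Empty using (⊥-elim)
  open import Relation.Nullary using (yes; no)
  open import Relation.Binary.PropositionalEquality
  open import Data.Nat.Tactic.RingSolver using (solve-∀)
  open FloorProduct
  open ProductBound

  telescope : ∀ (f : ℕ → ℕ) {a D} → (∀ σ → a ≤ σ → f σ + D ≤ f (suc σ)) → ∀ j → f a + j * D ≤ f (j + a)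
  telescope f {a} {D} step zero = ≤-reflexive (+-identityʳ (f a))
  telescope f {a} {D} step (suc j) = begin
    f a + (D + j * D)   ≡⟨ +-assoc-comm (f a) D (j * D) ⟩
    f a + j * D + D     ≤⟨ +-monoˡ-≤ D (telescope f step j) ⟩
    f (j + a) + D       ≤⟨ step (j + a) (m≤n+m a j) ⟩
    f (suc j + a)       ∎
    where
    open ≤-Reasoning
    +-assoc-comm : ∀ x y z → x + (y + z) ≡ x + z + y
    +-assoc-comm = solve-∀

  2[n/2]≤n : ∀ n → 2 * (n / 2) ≤ n
  2[n/2]≤n n = subst (_≤ n) (*-comm (n / 2) 2) (m/n*n≤m n 2)

  half-steps : ∀ {n t} → 2 ≤ n → 1 ≤ t → t ≤ n → ∃ λ j → 1 ≤ j × j ≤ t × t ≤ 3 * j × 2 * j ≤ n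
  half-steps {n} {t} 2≤n 1≤t t≤n with t ≤? n / 2
  ... | yes t≤n/2 = t , 1≤t , ≤-refl , m≤n*m t 3 , ≤-trans (*-monoʳ-≤ 2 t≤n/2) (2[n/2]≤n n)
  ... | no t≰n/2 = n / 2 , 1≤n/2 , <⇒≤ (≰⇒> t≰n/2) , ≤-trans t≤n n≤3[n/2] , 2[n/2]≤n n
    where
    open ≤-Reasoning
    1≤n/2 : 1 ≤ n / 2
    1≤n/2 = m≥n⇒m/n>0 2≤n
    n≤3[n/2] : n ≤ 3 * (n / 2)
    n≤3[n/2] = begin
      n                     ≡⟨ m≡m%n+[m/n]*n n 2 ⟩
      n % 2 + n / 2 * 2     ≤⟨ +-monoˡ-≤ (n / 2 * 2) (≤-trans (s≤s⁻¹ (m%n<n n 2)) 1≤n/2) ⟩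
      n / 2 + n / 2 * 2     ≡⟨ three-halves (n / 2) ⟩
      3 * (n / 2)           ∎
      where
      three-halves : ∀ h → h + h * 2 ≡ 3 * h
      three-halves = solve-∀

  -- Chosen so that ⌊n/4m⌋ > 3 (8m)^(k-1) for m = k + 1; see gain-large.
  threshold : ℕ → ℕ
  threshold k = suc (3 * (8 * suc k) ^ (k ∸ 1)) * (4 * suc k)

  suc≤threshold : ∀ k → suc k ≤ threshold k
  suc≤threshold k = ≤-trans (m≤n*m (suc k) 4) (m≤n*m (4 * suc k) (suc (3 * (8 * suc k) ^ (k ∸ 1))))

  module _ (e : ℕ) where

    private
      k m : ℕ
      k = suc e
      m = suc k

    -- For n/2 ≤ σ the quotient ⌊σ/m⌋ is at least q = ⌊n/4m⌋, and q^k exceeds 3 n^(k-1)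
    -- as soon as q > 3 (8m)^(k-1), because n ≤ 8 m q.
    gain-large : ∀ {n σ} → threshold k ≤ n → n ≤ 2 * σ →
      balancedProduct k σ + (3 * n ^ e + 1) ≤ balancedProduct k (suc σ)
    gain-large {n} {σ} n₀≤n n≤2σ = begin
      balancedProduct k σ + (3 * n ^ e + 1)          ≤⟨ +-monoʳ-≤ (balancedProduct k σ) (≤-trans 3n^e+1≤q^k (pow≤gain k {q} qm≤σ)) ⟩
      balancedProduct k σ + balancedProduct-gain k σ ≡⟨ balancedProduct-suc k σ ⟨
      balancedProduct k (suc σ)                      ∎
      where
      open ≤-Reasoning
      C : ℕ
      C = 3 * (8 * m) ^ e
      q : ℕ
      q = n / (4 * m)
      suc-C≤q : suc C ≤ q
      suc-C≤q = subst (_≤ q) (m*n/n≡m (suc C) (4 * m)) (/-monoˡ-≤ (4 * m) n₀≤n)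
      qm≤σ : q * m ≤ σ
      qm≤σ = *-cancelˡ-≤ 2 (begin
        2 * (q * m)     ≤⟨ m≤m+n (2 * (q * m)) (2 * (q * m)) ⟩
        2 * (q * m) + 2 * (q * m) ≡⟨ four q m ⟩
        q * (4 * m)     ≤⟨ m/n*n≤m n (4 * m) ⟩
        n               ≤⟨ n≤2σ ⟩
        2 * σ           ∎)
        where
        four : ∀ q m → 2 * (q * m) + 2 * (q * m) ≡ q * (4 * m)
        four = solve-∀
      n≤8mq : n ≤ q * (8 * m)
      n≤8mq = begin
        n                           ≡⟨ m≡m%n+[m/n]*n n (4 * m) ⟩
        n % (4 * m) + q * (4 * m)   ≤⟨ +-monoˡ-≤ (q * (4 * m)) (<⇒≤ (m%n<n n (4 * m))) ⟩
        4 * m + q * (4 * m)         ≤⟨ +-monoˡ-≤ (q * (4 * m)) (m≤n*m (4 * m) q {{>-nonZero (≤-trans (s≤s z≤n) suc-C≤q)}}) ⟩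
        q * (4 * m) + q * (4 * m)   ≡⟨ eight q m ⟩
        q * (8 * m)                 ∎
        where
        eight : ∀ q m → q * (4 * m) + q * (4 * m) ≡ q * (8 * m)
        eight = solve-∀
      1≤q^e : 1 ≤ q ^ e
      1≤q^e = subst (_≤ q ^ e) (^-zeroˡ e) (^-monoˡ-≤ e (≤-trans (s≤s z≤n) suc-C≤q))
      3n^e+1≤q^k : 3 * n ^ e + 1 ≤ q ^ k
      3n^e+1≤q^k = begin
        3 * n ^ e + 1               ≤⟨ +-monoˡ-≤ 1 (*-monoʳ-≤ 3 (^-monoˡ-≤ e n≤8mq)) ⟩
        3 * (q * (8 * m)) ^ e + 1   ≡⟨ cong (λ x → 3 * x + 1) (^-distribʳ-* q (8 * m) e) ⟩
        3 * (q ^ e * (8 * m) ^ e) + 1 ≡⟨ regroup (q ^ e) ((8 * m) ^ e) ⟩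
        C * q ^ e + 1               ≤⟨ +-monoʳ-≤ (C * q ^ e) 1≤q^e ⟩
        C * q ^ e + q ^ e           ≡⟨ +-comm (C * q ^ e) (q ^ e) ⟩
        suc C * q ^ e               ≤⟨ *-monoˡ-≤ (q ^ e) suc-C≤q ⟩
        q * q ^ e                   ∎
        where
        regroup : ∀ x y → 3 * (x * y) + 1 ≡ 3 * y * x + 1
        regroup = solve-∀

    -- Each of the j ≥ t/3 steps from n - j up to n gains more than 3 n^(k-1).
    deficit : ∀ {n t} → threshold k ≤ n → 1 ≤ t → t ≤ n →
      balancedProduct k (n ∸ t) + t * n ^ e < balancedProduct k n
    deficit {n} {t} n₀≤n 1≤t t≤n
      with j , 1≤j , j≤t , t≤3j , 2j≤n ← half-steps (≤-trans (s≤s (s≤s z≤n)) (≤-trans (suc≤threshold k) n₀≤n)) 1≤t t≤n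
      = begin-strict
      balancedProduct k (n ∸ t) + t * n ^ e
        ≤⟨ +-mono-≤ (balancedProduct-mono-≤ k (∸-monoʳ-≤ n j≤t)) (*-monoˡ-≤ (n ^ e) t≤3j) ⟩
      balancedProduct k (n ∸ j) + 3 * j * n ^ e      <⟨ +-monoʳ-< (balancedProduct k (n ∸ j)) (m<m+n (3 * j * n ^ e) 1≤j) ⟩
      balancedProduct k (n ∸ j) + (3 * j * n ^ e + j) ≡⟨ cong (balancedProduct k (n ∸ j) +_) (distrib j (n ^ e)) ⟩
      balancedProduct k (n ∸ j) + j * (3 * n ^ e + 1) ≤⟨ telescope (balancedProduct k) large j ⟩
      balancedProduct k (j + (n ∸ j))                ≡⟨ cong (balancedProduct k) (m+[n∸m]≡n j≤n) ⟩
      balancedProduct k n                            ∎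
      where
      open ≤-Reasoning
      j≤n : j ≤ n
      j≤n = ≤-trans j≤t t≤n
      distrib : ∀ j x → 3 * j * x + j ≡ j * (3 * x + 1)
      distrib = solve-∀
      n≤2[n∸j] : n ≤ 2 * (n ∸ j)
      n≤2[n∸j] = begin
        n                     ≡⟨ m+[n∸m]≡n j≤n ⟨
        j + (n ∸ j)           ≤⟨ +-monoˡ-≤ (n ∸ j) j≤n∸j ⟩
        (n ∸ j) + (n ∸ j)     ≡⟨ cong ((n ∸ j) +_) (+-identityʳ (n ∸ j)) ⟨
        2 * (n ∸ j)           ∎
        where
        j≤n∸j : j ≤ n ∸ j
        j≤n∸j = m+n≤o⇒m≤o∸n j (subst (_≤ n) (cong (j +_) (+-identityʳ j)) 2j≤n)
      large : ∀ σ → n ∸ j ≤ σ → balancedProduct k σ + (3 * n ^ e + 1) ≤ balancedProduct k (suc σ)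
      large σ n∸j≤σ = gain-large n₀≤n (≤-trans n≤2[n∸j] (*-monoʳ-≤ 2 n∸j≤σ))

  excess<balancedProduct : ∀ e {n t} xs → threshold (suc e) ≤ n → length xs ≡ suc (suc e) → sum xs + suc t ≤ n →
    product xs + suc t * n ^ e < balancedProduct (suc e) n
  excess<balancedProduct e {n} {t} xs n₀≤n length≡ sum+t≤n = begin-strict
    product xs + suc t * n ^ e                          ≤⟨ +-monoˡ-≤ (suc t * n ^ e) Πxs≤ ⟩
    balancedProduct (suc e) (n ∸ suc t) + suc t * n ^ e <⟨ deficit e n₀≤n (s≤s z≤n) (m+n≤o⇒n≤o (sum xs) sum+t≤n) ⟩
    balancedProduct (suc e) n                           ∎
    where
    open ≤-Reasoning
    Πxs≤ : product xs ≤ balancedProduct (suc e) (n ∸ suc t)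
    Πxs≤ = ≤-trans (product≤balancedProduct (suc e) xs length≡) (balancedProduct-mono-≤ (suc e) (m+n≤o⇒m≤o∸n (sum xs) sum+t≤n))

  excess-dichotomy : ∀ k {n t} xs → threshold k ≤ n → length xs ≡ suc k → sum xs + t ≤ n → (k ≡ 0 → t ≡ 0) →
    t ≡ 0 ⊎ (product xs + t * n ^ (k ∸ 1) < balancedProduct k n)
  excess-dichotomy k {t = zero} _ _ _ _ _ = inj₁ refl
  excess-dichotomy zero {t = suc t} _ _ _ _ k≡0⇒t≡0 with () ← k≡0⇒t≡0 refl
  excess-dichotomy (suc e) {t = suc t} xs n₀≤n length≡ sum+t≤n _ = inj₂ (excess<balancedProduct e xs n₀≤n length≡ sum+t≤n)

  -- With xs the sizes of the private parts of a family and t the number of shared points,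
  -- product xs + t n^(k-1) bounds its number of minimal covers (see minCoverCount≤).
  module Excess (k : ℕ) {n t : ℕ} (xs : List ℕ) (n₀≤n : threshold k ≤ n) (length≡ : length xs ≡ suc k)
                (sum+t≤n : sum xs + t ≤ n) (k≡0⇒t≡0 : k ≡ 0 → t ≡ 0) where

    private
      m≤n : suc k ≤ n
      m≤n = ≤-trans (suc≤threshold k) n₀≤n

    excess≤balancedProduct : product xs + t * n ^ (k ∸ 1) ≤ balancedProduct k n
    excess≤balancedProduct with excess-dichotomy k xs n₀≤n length≡ sum+t≤n k≡0⇒t≡0
    ... | inj₂ excess< = <⇒≤ excess<
    ... | inj₁ refl = begin
      product xs + 0             ≡⟨ +-identityʳ (product xs) ⟩
      product xs                 ≤⟨ product≤balancedProduct k xs length≡ ⟩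
      balancedProduct k (sum xs) ≤⟨ balancedProduct-mono-≤ k (m+n≤o⇒m≤o (sum xs) sum+t≤n) ⟩
      balancedProduct k n        ∎
      where open ≤-Reasoning

    excess≡balancedProduct⇒ : product xs + t * n ^ (k ∸ 1) ≡ balancedProduct k n →
      t ≡ 0 × sum xs ≡ n × Balanced xs × 1 ≤ product xs
    excess≡balancedProduct⇒ excess≡ with excess-dichotomy k xs n₀≤n length≡ sum+t≤n k≡0⇒t≡0
    ... | inj₂ excess< = ⊥-elim (<-irrefl excess≡ excess<)
    ... | inj₁ refl = refl , sum≡n , product≡balancedProduct⇒Balanced k xs length≡ 1≤Πxs Πxs≡B[sum] , 1≤Πxs
      where
      Πxs≡Bn : product xs ≡ balancedProduct k n
      Πxs≡Bn = trans (sym (+-identityʳ (product xs))) excess≡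
      1≤Πxs : 1 ≤ product xs
      1≤Πxs = subst (1 ≤_) (sym Πxs≡Bn) (balancedProduct-pos k m≤n)
      sum≤n : sum xs ≤ n
      sum≤n = m+n≤o⇒m≤o (sum xs) sum+t≤n
      Bn≤B[sum] : balancedProduct k n ≤ balancedProduct k (sum xs)
      Bn≤B[sum] = ≤-trans (≤-reflexive (sym Πxs≡Bn)) (product≤balancedProduct k xs length≡)
      sum≡n : sum xs ≡ n
      sum≡n with m≤n⇒m<n∨m≡n sum≤n
      ... | inj₂ sum≡n = sum≡n
      ... | inj₁ sum<n = ⊥-elim (<⇒≱ (balancedProduct-mono-< k m≤n sum<n) Bn≤B[sum])
      Πxs≡B[sum] : product xs ≡ balancedProduct k (sum xs)
      Πxs≡B[sum] = trans Πxs≡Bn (cong (balancedProduct k) (sym sum≡n))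

module Asymptotics where

  open import Data.Nat
  open import Data.Nat.Properties
  open import Data.Nat.DivMod
  open import Data.Product using (_×_; _,_)
  open import Relation.Binary.PropositionalEquality
  open import Data.Nat.Tactic.RingSolver using (solve-∀)
  open import Defs using (floorProd)
  open FloorProduct using (^-distribʳ-*)

  ^-mean-value-≤ : ∀ a d j → (a + d) ^ suc j ≤ a ^ suc j + suc j * d * (a + d) ^ j
  ^-mean-value-≤ a d zero = ≤-reflexive (base a d)
    where
    base : ∀ a d → (a + d) * 1 ≡ a * 1 + 1 * d * 1
    base = solve-∀
  ^-mean-value-≤ a d (suc j) = begin
    (a + d) * (a + d) ^ suc j                                ≤⟨ *-monoʳ-≤ (a + d) (^-mean-value-≤ a d j) ⟩
    (a + d) * (X + suc j * d * Y)                            ≡⟨ expand a d X Y j ⟩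
    a * X + d * X + suc j * d * ((a + d) * Y)                ≤⟨ +-monoˡ-≤ _ (+-monoʳ-≤ (a * X) (*-monoʳ-≤ d X≤[a+d]Y)) ⟩
    a * X + d * ((a + d) * Y) + suc j * d * ((a + d) * Y)    ≡⟨ collect a d X ((a + d) * Y) j ⟩
    a * X + suc (suc j) * d * ((a + d) * Y)                  ∎
    where
    open ≤-Reasoning
    X : ℕ
    X = a ^ suc j
    Y : ℕ
    Y = (a + d) ^ j
    X≤[a+d]Y : X ≤ (a + d) * Y
    X≤[a+d]Y = ^-monoˡ-≤ (suc j) (m≤m+n a d)
    expand : ∀ a d X Y j → (a + d) * (X + suc j * d * Y) ≡ a * X + d * X + suc j * d * ((a + d) * Y)
    expand = solve-∀
    collect : ∀ a d X Z j → a * X + d * Z + suc j * d * Z ≡ a * X + suc (suc j) * d * Z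
    collect = solve-∀

  module _ (k n : ℕ) where

    private
      m : ℕ
      m = suc k

    floorProd-scaled-suc : ∀ j → floorProd n m (suc j) * m ^ suc j ≡ (n + j) / m * m * (floorProd n m j * m ^ j)
    floorProd-scaled-suc j = interchange (floorProd n m j) ((n + j) / m) m (m ^ j)
      where
      interchange : ∀ f x m y → f * x * (m * y) ≡ x * m * (f * y)
      interchange = solve-∀

    floorProd-scaled-≥ : ∀ j → j ≤ m → (n ∸ k) ^ j ≤ floorProd n m j * m ^ j
    floorProd-scaled-≥ zero _ = ≤-refl
    floorProd-scaled-≥ (suc j) j<m = begin
      (n ∸ k) * (n ∸ k) ^ j                          ≤⟨ *-mono-≤ factor≥ (floorProd-scaled-≥ j (<⇒≤ j<m)) ⟩
      (n + j) / m * m * (floorProd n m j * m ^ j)    ≡⟨ floorProd-scaled-suc j ⟨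
      floorProd n m (suc j) * m ^ suc j              ∎
      where
      open ≤-Reasoning
      factor≥ : n ∸ k ≤ (n + j) / m * m
      factor≥ = begin
        n ∸ k                                  ≤⟨ ∸-monoˡ-≤ k (m≤m+n n j) ⟩
        n + j ∸ k                              ≡⟨ cong (_∸ k) (m≡m%n+[m/n]*n (n + j) m) ⟩
        (n + j) % m + (n + j) / m * m ∸ k      ≤⟨ ∸-monoˡ-≤ k (+-monoˡ-≤ _ (s≤s⁻¹ (m%n<n (n + j) m))) ⟩
        k + (n + j) / m * m ∸ k                ≡⟨ m+n∸m≡n k _ ⟩
        (n + j) / m * m                        ∎

    floorProd-scaled-≤ : ∀ j → j ≤ m → floorProd n m j * m ^ j ≤ (n + k) ^ j
    floorProd-scaled-≤ zero _ = ≤-refl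
    floorProd-scaled-≤ (suc j) j<m = begin
      floorProd n m (suc j) * m ^ suc j              ≡⟨ floorProd-scaled-suc j ⟩
      (n + j) / m * m * (floorProd n m j * m ^ j)    ≤⟨ *-mono-≤ factor≤ (floorProd-scaled-≤ j (<⇒≤ j<m)) ⟩
      (n + k) * (n + k) ^ j                          ∎
      where
      open ≤-Reasoning
      factor≤ : (n + j) / m * m ≤ n + k
      factor≤ = ≤-trans (m/n*n≤m (n + j) m) (+-monoʳ-≤ n (s≤s⁻¹ j<m))

    errorBound : ℕ
    errorBound = m * (2 * k) * (n + k) ^ k

    module _ (k≤n : k ≤ n) where

      private
        n+k≡ : n ∸ k + 2 * k ≡ n + k
        n+k≡ = begin
          n ∸ k + 2 * k       ≡⟨ cong (n ∸ k +_) (cong (k +_) (+-identityʳ k)) ⟩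
          n ∸ k + (k + k)     ≡⟨ +-assoc (n ∸ k) k k ⟨
          n ∸ k + k + k       ≡⟨ cong (_+ k) (m∸n+n≡m k≤n) ⟩
          n + k               ∎
          where open ≡-Reasoning

        spread : (n + k) ^ m ≤ (n ∸ k) ^ m + errorBound
        spread = subst (λ x → x ^ m ≤ (n ∸ k) ^ m + m * (2 * k) * x ^ k) n+k≡ (^-mean-value-≤ (n ∸ k) (2 * k) k)

      scaledFloorProd≤ : floorProd n m m * m ^ m ≤ n ^ m + errorBound
      scaledFloorProd≤ = begin
        floorProd n m m * m ^ m   ≤⟨ floorProd-scaled-≤ m ≤-refl ⟩
        (n + k) ^ m               ≤⟨ spread ⟩
        (n ∸ k) ^ m + errorBound       ≤⟨ +-monoˡ-≤ errorBound (^-monoˡ-≤ m (m∸n≤m n k)) ⟩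
        n ^ m + errorBound             ∎
        where open ≤-Reasoning

      pow≤scaledFloorProd : n ^ m ≤ floorProd n m m * m ^ m + errorBound
      pow≤scaledFloorProd = begin
        n ^ m                              ≤⟨ ^-monoˡ-≤ m (m≤m+n n k) ⟩
        (n + k) ^ m                        ≤⟨ spread ⟩
        (n ∸ k) ^ m + errorBound                ≤⟨ +-monoˡ-≤ errorBound (floorProd-scaled-≥ m ≤-refl) ⟩
        floorProd n m m * m ^ m + errorBound    ∎
        where open ≤-Reasoning

    -- With K = q m 2k 2^k: q · errorBound ≤ K n^k ≤ n^(k+1) once n ≥ K + k, as n + k ≤ 2n.
    errorBound-small : ∀ p q → q * m * (2 * k) * 2 ^ k + k ≤ n → q * errorBound ≤ suc p * n ^ m
    errorBound-small p q N≤n = begin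
      q * (m * (2 * k) * (n + k) ^ k)             ≤⟨ *-monoʳ-≤ q (*-monoʳ-≤ (m * (2 * k)) (^-monoˡ-≤ k n+k≤2n)) ⟩
      q * (m * (2 * k) * (2 * n) ^ k)             ≡⟨ cong (λ x → q * (m * (2 * k) * x)) (^-distribʳ-* 2 n k) ⟩
      q * (m * (2 * k) * (2 ^ k * n ^ k))         ≡⟨ regroup q m k (2 ^ k) (n ^ k) ⟩
      K * n ^ k                                   ≤⟨ *-monoˡ-≤ (n ^ k) (m+n≤o⇒m≤o K N≤n) ⟩
      n * n ^ k                                   ≤⟨ m≤m+n (n * n ^ k) (p * (n * n ^ k)) ⟩
      suc p * n ^ m                               ∎
      where
      open ≤-Reasoning
      K : ℕ
      K = q * m * (2 * k) * 2 ^ k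
      n+k≤2n : n + k ≤ 2 * n
      n+k≤2n = subst (n + k ≤_) (cong (n +_) (sym (+-identityʳ n))) (+-monoʳ-≤ n (m+n≤o⇒n≤o K N≤n))
      regroup : ∀ q m k t x → q * (m * (2 * k) * (t * x)) ≡ q * m * (2 * k) * t * x
      regroup = solve-∀

module RelativeError where

  open import Data.Nat as ℕ using (ℕ; suc)
  import Data.Nat.Properties as ℕ
  open import Data.Nat.Coprimality using (Coprime; 1-coprimeTo)
  import Data.Nat.Coprimality as Coprimality
  open import Data.Integer as ℤ using (+_; +[1+_])
  import Data.Integer.Properties as ℤ
  open import Data.Rational
  open import Data.Rational.Properties
  import Data.Rational.Unnormalised as ℚᵘ
  import Data.Rational.Unnormalised.Properties as ℚᵘ
  open import Algebra.Properties.AbelianGroup +-0-abelianGroup using (xyx⁻¹≈y; ⁻¹-anti-homo‿-)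
  open import Data.Product using (Σ; _,_)
  open import Data.Sum using (inj₁; inj₂)
  open import Relation.Binary.PropositionalEquality
  open import Defs using (floorProd; ℕ→ℚ)
  open Asymptotics

  private
    -- The normal form of ℕ→ℚ k, on which the operations of ℚ compute.
    toQ : ℕ → ℚ
    toQ k = mkℚ (+ k) 0 (Coprimality.sym (1-coprimeTo k))

    ℕ→ℚ≡toQ : ∀ k → ℕ→ℚ k ≡ toQ k
    ℕ→ℚ≡toQ k = normalize-coprime (Coprimality.sym (1-coprimeTo k))

  ℕ→ℚ-mono-≤ : ∀ {a b} → a ℕ.≤ b → ℕ→ℚ a ≤ ℕ→ℚ b
  ℕ→ℚ-mono-≤ {a} {b} a≤b = subst₂ _≤_ (sym (ℕ→ℚ≡toQ a)) (sym (ℕ→ℚ≡toQ b))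
    (*≤* (subst₂ ℤ._≤_ (sym (ℤ.*-identityʳ (+ a))) (sym (ℤ.*-identityʳ (+ b))) (ℤ.+≤+ a≤b)))

  ℕ→ℚ-homo-+ : ∀ a b → ℕ→ℚ (a ℕ.+ b) ≡ ℕ→ℚ a + ℕ→ℚ b
  ℕ→ℚ-homo-+ a b = begin
    ℕ→ℚ (a ℕ.+ b)   ≡⟨ ℕ→ℚ≡toQ (a ℕ.+ b) ⟩
    toQ (a ℕ.+ b)   ≡⟨ toℚᵘ-injective (ℚᵘ.≃-trans (ℚᵘ.*≡* cross-multiplied) (ℚᵘ.≃-sym (toℚᵘ-homo-+ (toQ a) (toQ b)))) ⟩
    toQ a + toQ b   ≡⟨ cong₂ _+_ (ℕ→ℚ≡toQ a) (ℕ→ℚ≡toQ b) ⟨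
    ℕ→ℚ a + ℕ→ℚ b   ∎
    where
    open ≡-Reasoning
    cross-multiplied : + (a ℕ.+ b) ℤ.* + 1 ≡ (+ a ℤ.* + 1 ℤ.+ + b ℤ.* + 1) ℤ.* + 1
    cross-multiplied = begin
      + (a ℕ.+ b) ℤ.* + 1                ≡⟨ ℤ.*-identityʳ _ ⟩
      + a ℤ.+ + b                        ≡⟨ cong₂ ℤ._+_ (ℤ.*-identityʳ (+ a)) (ℤ.*-identityʳ (+ b)) ⟨
      + a ℤ.* + 1 ℤ.+ + b ℤ.* + 1        ≡⟨ ℤ.*-identityʳ _ ⟨
      (+ a ℤ.* + 1 ℤ.+ + b ℤ.* + 1) ℤ.* + 1 ∎

  ℕ→ℚ-homo-* : ∀ a b → ℕ→ℚ (a ℕ.* b) ≡ ℕ→ℚ a * ℕ→ℚ b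
  ℕ→ℚ-homo-* a b = begin
    ℕ→ℚ (a ℕ.* b)   ≡⟨ ℕ→ℚ≡toQ (a ℕ.* b) ⟩
    toQ (a ℕ.* b)
      ≡⟨ toℚᵘ-injective (ℚᵘ.≃-trans (ℚᵘ.*≡* (cong (ℤ._* + 1) (ℤ.pos-* a b))) (ℚᵘ.≃-sym (toℚᵘ-homo-* (toQ a) (toQ b)))) ⟩
    toQ a * toQ b   ≡⟨ cong₂ _*_ (ℕ→ℚ≡toQ a) (ℕ→ℚ≡toQ b) ⟨
    ℕ→ℚ a * ℕ→ℚ b   ∎
    where open ≡-Reasoning

  ∣ℕ→ℚ∣ : ∀ a → ∣ ℕ→ℚ a ∣ ≡ ℕ→ℚ a
  ∣ℕ→ℚ∣ a = trans (cong ∣_∣ (ℕ→ℚ≡toQ a)) (sym (ℕ→ℚ≡toQ a))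

  ∣p-q∣≡∣q-p∣ : ∀ p q → ∣ p - q ∣ ≡ ∣ q - p ∣
  ∣p-q∣≡∣q-p∣ p q = trans (sym (∣-p∣≡∣p∣ (p - q))) (cong ∣_∣ (⁻¹-anti-homo‿- p q))

  ∣ℕ→ℚ[b+c]-ℕ→ℚb∣ : ∀ b c → ∣ ℕ→ℚ (b ℕ.+ c) - ℕ→ℚ b ∣ ≡ ℕ→ℚ c
  ∣ℕ→ℚ[b+c]-ℕ→ℚb∣ b c = begin
    ∣ ℕ→ℚ (b ℕ.+ c) - ℕ→ℚ b ∣       ≡⟨ cong (λ x → ∣ x - ℕ→ℚ b ∣) (ℕ→ℚ-homo-+ b c) ⟩
    ∣ ℕ→ℚ b + ℕ→ℚ c - ℕ→ℚ b ∣       ≡⟨ cong ∣_∣ (xyx⁻¹≈y (ℕ→ℚ b) (ℕ→ℚ c)) ⟩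
    ∣ ℕ→ℚ c ∣                       ≡⟨ ∣ℕ→ℚ∣ c ⟩
    ℕ→ℚ c                           ∎
    where open ≡-Reasoning

  private
    ∣ℕ→ℚ-ℕ→ℚ∣≤-from-≤ : ∀ {a b d} → b ℕ.≤ a → a ℕ.≤ b ℕ.+ d → ∣ ℕ→ℚ a - ℕ→ℚ b ∣ ≤ ℕ→ℚ d
    ∣ℕ→ℚ-ℕ→ℚ∣≤-from-≤ {a} {b} {d} b≤a a≤b+d = begin
      ∣ ℕ→ℚ a - ℕ→ℚ b ∣                  ≡⟨ cong (λ x → ∣ ℕ→ℚ x - ℕ→ℚ b ∣) (ℕ.m+[n∸m]≡n b≤a) ⟨
      ∣ ℕ→ℚ (b ℕ.+ (a ℕ.∸ b)) - ℕ→ℚ b ∣  ≡⟨ ∣ℕ→ℚ[b+c]-ℕ→ℚb∣ b (a ℕ.∸ b) ⟩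
      ℕ→ℚ (a ℕ.∸ b)                      ≤⟨ ℕ→ℚ-mono-≤ (ℕ.≤-trans (ℕ.∸-monoˡ-≤ b a≤b+d) (ℕ.≤-reflexive (ℕ.m+n∸m≡n b d))) ⟩
      ℕ→ℚ d                              ∎
      where open ≤-Reasoning

  ∣ℕ→ℚ-ℕ→ℚ∣≤ : ∀ {a b d} → a ℕ.≤ b ℕ.+ d → b ℕ.≤ a ℕ.+ d → ∣ ℕ→ℚ a - ℕ→ℚ b ∣ ≤ ℕ→ℚ d
  ∣ℕ→ℚ-ℕ→ℚ∣≤ {a} {b} a≤b+d b≤a+d with ℕ.≤-total b a
  ... | inj₁ b≤a = ∣ℕ→ℚ-ℕ→ℚ∣≤-from-≤ b≤a a≤b+d
  ... | inj₂ a≤b = subst (_≤ _) (∣p-q∣≡∣q-p∣ (ℕ→ℚ b) (ℕ→ℚ a)) (∣ℕ→ℚ-ℕ→ℚ∣≤-from-≤ a≤b b≤a+d)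

  module _ (p q-1 : ℕ) .(c : Coprime (suc p) (suc q-1)) where

    private
      ε : ℚ
      ε = mkℚ +[1+ p ] q-1 c

      ε*q≡p : ε * toQ (suc q-1) ≡ toQ (suc p)
      ε*q≡p = toℚᵘ-injective (ℚᵘ.≃-trans (toℚᵘ-homo-* ε (toQ (suc q-1))) (ℚᵘ.*≡* cross-multiplied))
        where
        cross-multiplied : (+[1+ p ] ℤ.* + suc q-1) ℤ.* + 1 ≡ + suc p ℤ.* + suc (q-1 ℕ.* 1)
        cross-multiplied = begin
          (+[1+ p ] ℤ.* + suc q-1) ℤ.* + 1 ≡⟨ ℤ.*-identityʳ _ ⟩
          + suc p ℤ.* + suc q-1           ≡⟨ cong (λ x → + suc p ℤ.* + x) (ℕ.*-identityʳ (suc q-1)) ⟨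
          + suc p ℤ.* + suc (q-1 ℕ.* 1)   ∎
          where open ≡-Reasoning

    ℕ→ℚ≤ε*ℕ→ℚ : ∀ {e n} → suc q-1 ℕ.* e ℕ.≤ suc p ℕ.* n → ℕ→ℚ e ≤ ε * ℕ→ℚ n
    ℕ→ℚ≤ε*ℕ→ℚ {e} {n} qe≤pn =
      subst₂ (λ x y → x ≤ ε * y) (sym (ℕ→ℚ≡toQ e)) (sym (ℕ→ℚ≡toQ n)) (*-cancelˡ-≤-pos q (begin
      q * toQ e                ≡⟨ cong₂ _*_ (ℕ→ℚ≡toQ (suc q-1)) (ℕ→ℚ≡toQ e) ⟨
      ℕ→ℚ (suc q-1) * ℕ→ℚ e   ≡⟨ ℕ→ℚ-homo-* (suc q-1) e ⟨
      ℕ→ℚ (suc q-1 ℕ.* e)     ≤⟨ ℕ→ℚ-mono-≤ qe≤pn ⟩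
      ℕ→ℚ (suc p ℕ.* n)       ≡⟨ ℕ→ℚ-homo-* (suc p) n ⟩
      ℕ→ℚ (suc p) * ℕ→ℚ n     ≡⟨ cong₂ _*_ (ℕ→ℚ≡toQ (suc p)) (ℕ→ℚ≡toQ n) ⟩
      toQ (suc p) * toQ n     ≡⟨ cong (_* toQ n) ε*q≡p ⟨
      ε * q * toQ n           ≡⟨ cong (_* toQ n) (*-comm ε q) ⟩
      q * ε * toQ n           ≡⟨ *-assoc q ε (toQ n) ⟩
      q * (ε * toQ n)         ∎))
      where
      open ≤-Reasoning
      q : ℚ
      q = toQ (suc q-1)

  relative-error : ∀ k (ε : ℚ) → Positive ε → Σ ℕ λ N → ∀ n → N ℕ.≤ n →
    ∣ ℕ→ℚ (floorProd n (suc k) (suc k) ℕ.* suc k ℕ.^ suc k) - ℕ→ℚ (n ℕ.^ suc k) ∣ ≤ ε * ℕ→ℚ (n ℕ.^ suc k)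
  relative-error k ε@(mkℚ +[1+ p ] q-1 c) _ = N , bound
    where
    N : ℕ
    N = suc q-1 ℕ.* suc k ℕ.* (2 ℕ.* k) ℕ.* 2 ℕ.^ k ℕ.+ k
    bound : ∀ n → N ℕ.≤ n →
      ∣ ℕ→ℚ (floorProd n (suc k) (suc k) ℕ.* suc k ℕ.^ suc k) - ℕ→ℚ (n ℕ.^ suc k) ∣ ≤ ε * ℕ→ℚ (n ℕ.^ suc k)
    bound n N≤n = ≤-trans
      (∣ℕ→ℚ-ℕ→ℚ∣≤ (scaledFloorProd≤ k n k≤n) (pow≤scaledFloorProd k n k≤n))
      (ℕ→ℚ≤ε*ℕ→ℚ p q-1 c (errorBound-small k n p (suc q-1) N≤n))
      where
      k≤n : k ℕ.≤ n
      k≤n = ℕ.m+n≤o⇒n≤o (suc q-1 ℕ.* suc k ℕ.* (2 ℕ.* k) ℕ.* 2 ℕ.^ k) N≤n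

module FinSubsets where

  open import Data.Nat using (ℕ; zero; suc; _+_; _≤_)
  open import Data.Nat.Properties using (+-suc; <-irrefl)
  open import Data.Nat.ListAction using (sum)
  open import Data.Fin using (Fin; zero; suc)
  import Data.Fin.Properties as Fin
  open import Data.Fin.Subset using (Subset; _∈_; _∉_; _∩_; _∪_; ⋃; ⊥; ∣_∣; Nonempty; Empty; inside; outside)
  open import Data.Fin.Subset.Properties using (nonempty?; ∉⊥; ∣⊥∣≡0; x∈p∪q⁺; x∈p∪q⁻; x∈p∩q⁺; x∈p∩q⁻; Empty-unique)
  open import Data.Vec using ([]; _∷_; tabulate; here; there)
  open import Data.Vec.Properties using (lookup⇒[]=; []=⇒lookup; lookup∘tabulate)
  open import Data.List using (List; []; _∷_; length; map)
  open import Data.List.Properties using (length-map)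
  import Data.List.Membership.Propositional as List
  open import Data.List.Membership.Propositional.Properties using (∈-map⁺; ∈-map⁻)
  open import Data.List.Relation.Unary.Any using (Any; here; there)
  open import Data.List.Relation.Unary.All as All using (All; []; _∷_)
  open import Data.List.Relation.Unary.AllPairs using (AllPairs; []; _∷_)
  open import Data.List.Relation.Unary.Unique.Propositional using (Unique)
  import Data.List.Relation.Unary.Unique.Propositional.Properties as Unique
  import Data.List.Relation.Unary.All.Properties as All
  open import Data.Maybe using (Maybe; just; nothing)
  open import Data.Product using (∃; _,_)
  open import Data.Sum using (inj₁; inj₂)
  open import Data.Empty using (⊥-elim)
  open import Relation.Nullary using (does; proof; yes; no)
  open import Relation.Nullary.Reflects using (Reflects; invert)
  open import Relation.Nullary.Decidable using (dec-true)
  open import Relation.Unary using (Decidable)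
  open import Relation.Binary.PropositionalEquality

  module _ {n : ℕ} {P : Fin n → Set} (P? : Decidable P) where

    subsetOf : Subset n
    subsetOf = tabulate (λ x → does (P? x))

    ∈-subsetOf⁺ : ∀ {x} → P x → x ∈ subsetOf
    ∈-subsetOf⁺ {x} px = lookup⇒[]= x subsetOf (trans (lookup∘tabulate _ x) (dec-true (P? x) px))

    ∈-subsetOf⁻ : ∀ {x} → x ∈ subsetOf → P x
    ∈-subsetOf⁻ {x} x∈ = invert (subst (Reflects (P x)) (trans (sym (lookup∘tabulate _ x)) ([]=⇒lookup x∈)) (proof (P? x)))

  elements : ∀ {n} → Subset n → List (Fin n)
  elements [] = []
  elements (inside ∷ p) = zero ∷ map suc (elements p)
  elements (outside ∷ p) = map suc (elements p)

  ∈-elements⁺ : ∀ {n} {p : Subset n} {x} → x ∈ p → x List.∈ elements p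
  ∈-elements⁺ {p = inside ∷ p} here = here refl
  ∈-elements⁺ {p = inside ∷ p} (there x∈p) = there (∈-map⁺ suc (∈-elements⁺ x∈p))
  ∈-elements⁺ {p = outside ∷ p} (there x∈p) = ∈-map⁺ suc (∈-elements⁺ x∈p)

  ∈-elements⁻ : ∀ {n} {p : Subset n} {x} → x List.∈ elements p → x ∈ p
  ∈-elements⁻ {p = inside ∷ p} (here refl) = here
  ∈-elements⁻ {p = inside ∷ p} (there x∈) with _ , y∈ , refl ← ∈-map⁻ suc x∈ = there (∈-elements⁻ y∈)
  ∈-elements⁻ {p = outside ∷ p} x∈ with _ , y∈ , refl ← ∈-map⁻ suc x∈ = there (∈-elements⁻ y∈)

  length-elements : ∀ {n} (p : Subset n) → length (elements p) ≡ ∣ p ∣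
  length-elements [] = refl
  length-elements (inside ∷ p) = cong suc (trans (length-map suc (elements p)) (length-elements p))
  length-elements (outside ∷ p) = trans (length-map suc (elements p)) (length-elements p)

  elements-Unique : ∀ {n} (p : Subset n) → Unique (elements p)
  elements-Unique [] = []
  elements-Unique (inside ∷ p) = All.map⁺ (All.tabulate λ _ ()) ∷ Unique.map⁺ Fin.suc-injective (elements-Unique p)
  elements-Unique (outside ∷ p) = Unique.map⁺ Fin.suc-injective (elements-Unique p)

  first : ∀ {n} → Subset n → Maybe (Fin n)
  first p with nonempty? p
  ... | yes (x , _) = just x
  ... | no _ = nothing

  first-just : ∀ {n} {p : Subset n} {x} → first p ≡ just x → x ∈ p
  first-just {p = p} eq with nonempty? p
  first-just refl | yes (_ , x∈p) = x∈p

  first-nothing : ∀ {n} {p : Subset n} → first p ≡ nothing → Empty p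
  first-nothing {p = p} eq with nonempty? p
  first-nothing () | yes _
  first-nothing _ | no empty = empty

  first-nonempty : ∀ {n} {p : Subset n} → Nonempty p → ∃ λ x → first p ≡ just x
  first-nonempty {p = p} ne with nonempty? p
  ... | yes (x , _) = x , refl
  ... | no empty = ⊥-elim (empty ne)

  Disjoint : ∀ {n} → Subset n → Subset n → Set
  Disjoint p q = Empty (p ∩ q)

  ∣p∪q∣≡∣p∣+∣q∣ : ∀ {n} (p q : Subset n) → Disjoint p q → ∣ p ∪ q ∣ ≡ ∣ p ∣ + ∣ q ∣
  ∣p∪q∣≡∣p∣+∣q∣ [] [] _ = refl
  ∣p∪q∣≡∣p∣+∣q∣ (inside ∷ p) (inside ∷ q) disj = ⊥-elim (disj (zero , here))
  ∣p∪q∣≡∣p∣+∣q∣ (inside ∷ p) (outside ∷ q) disj =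
    cong suc (∣p∪q∣≡∣p∣+∣q∣ p q (λ (x , x∈) → disj (suc x , there x∈)))
  ∣p∪q∣≡∣p∣+∣q∣ (outside ∷ p) (inside ∷ q) disj =
    trans (cong suc (∣p∪q∣≡∣p∣+∣q∣ p q (λ (x , x∈) → disj (suc x , there x∈)))) (sym (+-suc ∣ p ∣ ∣ q ∣))
  ∣p∪q∣≡∣p∣+∣q∣ (outside ∷ p) (outside ∷ q) disj = ∣p∪q∣≡∣p∣+∣q∣ p q (λ (x , x∈) → disj (suc x , there x∈))

  ∈⋃⁺ : ∀ {n} {ps : List (Subset n)} {x} → Any (x ∈_) ps → x ∈ ⋃ ps
  ∈⋃⁺ (here x∈p) = x∈p∪q⁺ (inj₁ x∈p)
  ∈⋃⁺ (there x∈ps) = x∈p∪q⁺ (inj₂ (∈⋃⁺ x∈ps))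

  ∈⋃⁻ : ∀ {n} (ps : List (Subset n)) {x} → x ∈ ⋃ ps → Any (x ∈_) ps
  ∈⋃⁻ [] x∈⊥ = ⊥-elim (∉⊥ x∈⊥)
  ∈⋃⁻ (p ∷ ps) x∈ with x∈p∪q⁻ p (⋃ ps) x∈
  ... | inj₁ x∈p = here x∈p
  ... | inj₂ x∈⋃ps = there (∈⋃⁻ ps x∈⋃ps)

  sum-∣∣≡∣⋃∣ : ∀ {n} {ps : List (Subset n)} → AllPairs Disjoint ps → sum (map ∣_∣ ps) ≡ ∣ ⋃ ps ∣
  sum-∣∣≡∣⋃∣ {n} [] = sym (∣⊥∣≡0 n)
  sum-∣∣≡∣⋃∣ {ps = p ∷ ps} (p#ps ∷ ps#) =
    trans (cong (∣ p ∣ +_) (sum-∣∣≡∣⋃∣ ps#)) (sym (∣p∪q∣≡∣p∣+∣q∣ p (⋃ ps) p#⋃ps))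
    where
    p#⋃ps : Disjoint p (⋃ ps)
    p#⋃ps (x , x∈p∩⋃ps) with x∈p , x∈⋃ps ← x∈p∩q⁻ p (⋃ ps) x∈p∩⋃ps = disjoint-from-all p#ps (∈⋃⁻ ps x∈⋃ps) x∈p
      where
      disjoint-from-all : ∀ {qs} → All (Disjoint p) qs → Any (x ∈_) qs → x ∉ p
      disjoint-from-all (p#q ∷ _) (here x∈q) x∈p = p#q (x , x∈p∩q⁺ (x∈p , x∈q))
      disjoint-from-all (_ ∷ p#qs) (there x∈qs) = disjoint-from-all p#qs x∈qs

  1≤∣p∣⇒Nonempty : ∀ {n} (p : Subset n) → 1 ≤ ∣ p ∣ → Nonempty p
  1≤∣p∣⇒Nonempty {n} p 1≤∣p∣ with nonempty? p
  ... | yes p≠∅ = p≠∅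
  ... | no p-empty = ⊥-elim (<-irrefl (sym (trans (cong ∣_∣ (Empty-unique p-empty)) (∣⊥∣≡0 n))) 1≤∣p∣)

module MinimalCovers where

  open import Data.Nat
  open import Data.Nat.Properties
  open import Data.Nat.ListAction using (sum; product)
  open import Data.Bool.Properties using () renaming (_≟_ to _≟ᵇ_)
  open import Data.Fin using (Fin)
  import Data.Fin.Properties as Fin
  open import Data.Fin.Subset using (Subset; _∈_; _∉_; _∩_; _⊆_; _⊂_; _-_; ⋃; ⊤; ∣_∣; Nonempty; Empty)
  open import Data.Fin.Subset.Properties
    using ( _∈?_; nonempty?; x∈p∩q⁺; x∈p∩q⁻; x∈p⇒p-x⊂p; x∈p∧x≢y⇒x∈p-y; ⊆-antisym
          ; ∣p∣≤n; ∣p∣≡n⇒p≡⊤; ∈⊤; Empty-unique; ∣⊥∣≡0)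
  open import Data.Vec.Properties using () renaming (≡-dec to ≡-decᵛ)
  open import Data.List using (List; []; _∷_; [_]; _++_; length; map; filter; concatMap; allFin)
  open import Data.List.Properties
    using (length-map; length-++; length-filter; length-tabulate; map-∘; map-cong; map-cong-local; map-id)
  open import Data.List.Membership.Propositional using (find) renaming (_∈_ to _∈ₗ_)
  open import Data.List.Membership.Propositional.Properties
    using ( ∈-map⁺; ∈-map⁻; ∈-filter⁺; ∈-filter⁻; ∈-++⁺ˡ; ∈-++⁺ʳ; ∈-++⁻
          ; ∈-concatMap⁺; ∈-concatMap⁻; ∈-allFin; ∈-length)
  open import Data.List.Relation.Unary.Any as Any using (Any; here; there)
  import Data.List.Relation.Unary.Any.Properties as Any
  open import Data.List.Relation.Unary.All as All using (All; []; _∷_; all?)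
  import Data.List.Relation.Unary.All.Properties as All
  open import Data.List.Relation.Unary.All.Properties using (¬All⇒Any¬)
  open import Data.List.Relation.Unary.AllPairs using (AllPairs; []; _∷_)
  open import Data.List.Relation.Unary.Unique.Propositional using (Unique)
  import Data.List.Relation.Unary.Unique.Propositional.Properties as Unique
  open import Data.Maybe using (Maybe; just; nothing)
  import Data.Maybe.Properties as Maybe
  import Data.List.Membership.DecPropositional
  open import Data.Product using (Σ; ∃; _×_; _,_; _,′_; proj₁; proj₂)
  open import Data.Sum using (_⊎_; inj₁; inj₂)
  open import Data.Empty using (⊥-elim)
  open import Relation.Nullary using (¬_; yes; no; Dec)
  open import Relation.Nullary.Decidable using (_×-dec_; _⊎-dec_)
  open import Relation.Binary.Definitions using (DecidableEquality)
  open import Relation.Binary.PropositionalEquality hiding ([_])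
  open import Defs using (Family; sets; unique; size; IsCover; IsMinCover; MCcount; IsBalancedPartition)
  open ProductBound using (Balanced; 1≤product⇒1≤∈)
  open Lists
  open FinSubsets

  _≟ˢ_ : ∀ {n} → DecidableEquality (Subset n)
  _≟ˢ_ = ≡-decᵛ _≟ᵇ_

  module _ {n : ℕ} (𝓕 : Family n) where

    private
      Fs : List (Subset n)
      Fs = sets 𝓕

    degree : Fin n → ℕ
    degree x = length (filter (x ∈?_) Fs)

    privatePart : Subset n → Subset n
    privatePart F = subsetOf (λ x → x ∈? F ×-dec degree x ≟ 1)

    shared : Subset n
    shared = subsetOf (λ x → 2 ≤? degree x)

    privateSizes : List ℕ
    privateSizes = map ∣_∣ (map privatePart Fs)

    1≤degree : ∀ {F x} → F ∈ₗ Fs → x ∈ F → 1 ≤ degree x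
    1≤degree F∈ x∈F = ∈-length (∈-filter⁺ (_ ∈?_) F∈ x∈F)

    2≤degree : ∀ {F G x} → F ∈ₗ Fs → G ∈ₗ Fs → F ≢ G → x ∈ F → x ∈ G → 2 ≤ degree x
    2≤degree F∈ G∈ F≢G x∈F x∈G = ∈∈≢⇒2≤length (∈-filter⁺ (_ ∈?_) F∈ x∈F) (∈-filter⁺ (_ ∈?_) G∈ x∈G) F≢G

    degree≡1⇒unique : ∀ {F G x} → degree x ≡ 1 → F ∈ₗ Fs → G ∈ₗ Fs → x ∈ F → x ∈ G → F ≡ G
    degree≡1⇒unique {F} {G} degree≡1 F∈ G∈ x∈F x∈G with F ≟ˢ G
    ... | yes F≡G = F≡G
    ... | no F≢G = ⊥-elim (<-irrefl (sym degree≡1) (2≤degree F∈ G∈ F≢G x∈F x∈G))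

    degree≡1⇒covered : ∀ {x} → degree x ≡ 1 → ∃ λ F → F ∈ₗ Fs × x ∈ F
    degree≡1⇒covered {x} degree≡1 with filter (x ∈?_) Fs in hits≡
    ... | F ∷ _ = F , ∈-filter⁻ (x ∈?_) {xs = Fs} (subst (F ∈ₗ_) (sym hits≡) (here refl))

    ∈privatePart⁻ : ∀ {F x} → x ∈ privatePart F → x ∈ F × degree x ≡ 1
    ∈privatePart⁻ {F} = ∈-subsetOf⁻ (λ x → x ∈? F ×-dec degree x ≟ 1)

    ∈shared⁻ : ∀ {x} → x ∈ shared → 2 ≤ degree x
    ∈shared⁻ = ∈-subsetOf⁻ (λ x → 2 ≤? degree x)

    degree≡1⇒privatePart≡ : (∀ x → degree x ≡ 1) → ∀ F → privatePart F ≡ F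
    degree≡1⇒privatePart≡ degree≡1 F = ⊆-antisym (λ x∈ → proj₁ (∈privatePart⁻ x∈))
      (λ {x} x∈F → ∈-subsetOf⁺ (λ x → x ∈? F ×-dec degree x ≟ 1) (x∈F , degree≡1 x))

    unique⇒degree≡1 : ∀ {F x} → F ∈ₗ Fs → x ∈ F →
      (∀ {G H} → G ∈ₗ Fs → H ∈ₗ Fs → x ∈ G → x ∈ H → G ≡ H) → degree x ≡ 1
    unique⇒degree≡1 {x = x} F∈ x∈F same = ≤-antisym
      (Unique∧all-equal⇒length≤1 (Unique.filter⁺ (x ∈?_) (unique 𝓕)) λ G∈ H∈ →
        let G∈Fs , x∈G = ∈-filter⁻ (x ∈?_) {xs = Fs} G∈
            H∈Fs , x∈H = ∈-filter⁻ (x ∈?_) {xs = Fs} H∈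
        in same G∈Fs H∈Fs x∈G x∈H)
      (1≤degree F∈ x∈F)

    privateParts-disjoint : AllPairs Disjoint (map privatePart Fs)
    privateParts-disjoint = map-AllPairs privatePart (unique 𝓕) λ F∈ G∈ F≢G (x , x∈) →
      let x∈F , degree≡1 = ∈privatePart⁻ (proj₁ (x∈p∩q⁻ _ _ x∈))
          x∈G , _ = ∈privatePart⁻ (proj₂ (x∈p∩q⁻ _ _ x∈))
      in F≢G (degree≡1⇒unique degree≡1 F∈ G∈ x∈F x∈G)

    shared-disjoint : All (Disjoint shared) (map privatePart Fs)
    shared-disjoint = All.map⁺ (All.tabulate λ {F} _ (x , x∈) →
      let x∈shared , x∈private = x∈p∩q⁻ shared (privatePart F) x∈
      in <-irrefl (sym (proj₂ (∈privatePart⁻ x∈private))) (∈shared⁻ x∈shared))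

    sum-privateSizes+∣shared∣≤n : sum privateSizes + ∣ shared ∣ ≤ n
    sum-privateSizes+∣shared∣≤n = begin
      sum privateSizes + ∣ shared ∣ ≡⟨ +-comm (sum privateSizes) ∣ shared ∣ ⟩
      ∣ shared ∣ + sum privateSizes ≡⟨ sum-∣∣≡∣⋃∣ (shared-disjoint ∷ privateParts-disjoint) ⟩
      ∣ ⋃ (shared ∷ map privatePart Fs) ∣ ≤⟨ ∣p∣≤n (⋃ (shared ∷ map privatePart Fs)) ⟩
      n ∎
      where open ≤-Reasoning

    sum-privateSizes≡n⇒degree≡1 : sum privateSizes ≡ n → ∀ x → degree x ≡ 1
    sum-privateSizes≡n⇒degree≡1 sum≡n x =
      proj₂ (∈privatePart⁻ (proj₂ (Any.satisfied (Any.map⁻ (∈⋃⁻ (map privatePart Fs) x∈⋃)))))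
      where
      ⋃≡⊤ : ⋃ (map privatePart Fs) ≡ ⊤
      ⋃≡⊤ = ∣p∣≡n⇒p≡⊤ (trans (sym (sum-∣∣≡∣⋃∣ privateParts-disjoint)) sum≡n)
      x∈⋃ : x ∈ ⋃ (map privatePart Fs)
      x∈⋃ = subst (x ∈_) (sym ⋃≡⊤) ∈⊤

    size≡1⇒∣shared∣≡0 : size 𝓕 ≡ 1 → ∣ shared ∣ ≡ 0
    size≡1⇒∣shared∣≡0 size≡1 = trans (cong ∣_∣ (Empty-unique shared-empty)) (∣⊥∣≡0 n)
      where
      shared-empty : Empty shared
      shared-empty (x , x∈) = <⇒≱ (∈shared⁻ x∈) (≤-trans (length-filter (x ∈?_) Fs) (≤-reflexive size≡1))

    -- Otherwise A - x would still be a cover.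
    minCover-private : ∀ {A x} → IsMinCover 𝓕 A → x ∈ A →
      ∃ λ F → F ∈ₗ Fs × x ∈ F × (∀ {y} → y ∈ A → y ∈ F → y ≡ x)
    minCover-private {A} {x} (cover , minimal) x∈A with all? (λ F → nonempty? ((A - x) ∩ F)) Fs
    ... | yes A-x-covers = ⊥-elim (minimal (A - x) (x∈p⇒p-x⊂p x∈A) (λ F F∈ → All.lookup A-x-covers F∈))
    ... | no ¬A-x-covers with F , F∈ , A-x∩F-empty ← find (¬All⇒Any¬ (λ F → nonempty? ((A - x) ∩ F)) Fs ¬A-x-covers)
        = F , F∈ , x∈F , only-x
      where
      only-x : ∀ {y} → y ∈ A → y ∈ F → y ≡ x
      only-x {y} y∈A y∈F with y Fin.≟ x
      ... | yes y≡x = y≡x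
      ... | no y≢x = ⊥-elim (A-x∩F-empty (y , x∈p∩q⁺ (x∈p∧x≢y⇒x∈p-y y∈A y≢x , y∈F)))
      x∈F : x ∈ F
      x∈F with z , z∈A∩F ← cover F F∈ with z∈A , z∈F ← x∈p∩q⁻ A F z∈A∩F = subst (_∈ F) (only-x z∈A z∈F) z∈F

    -- A minimal cover A is coded by a shared element r of A (if any) and, for each member F,
    -- an element of A ∩ F, omitted when r ∈ F.
    Code : Set
    Code = Maybe (Fin n) × List (Maybe (Fin n))

    entry : Maybe (Fin n) → Subset n → Subset n → Maybe (Fin n)
    entry (just r) A F with r ∈? F
    ... | yes _ = nothing
    ... | no _ = first (A ∩ F)
    entry nothing A F = first (A ∩ F)

    code : Subset n → Code
    code A = first (A ∩ shared) , map (entry (first (A ∩ shared)) A) Fs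

    Decodes : Code → Fin n → Set
    Decodes (r , es) x = r ≡ just x ⊎ just x ∈ₗ es

    decodes? : ∀ c x → Dec (Decodes c x)
    decodes? (r , es) x = Maybe.≡-dec Fin._≟_ r (just x) ⊎-dec DecMembership._∈?_ (just x) es
      where
      module DecMembership = Data.List.Membership.DecPropositional (Maybe.≡-dec (Fin._≟_ {n}))

    decode : Code → Subset n
    decode c = subsetOf (decodes? c)

    entry∈ : ∀ r A F {y} → entry r A F ≡ just y → y ∈ A ∩ F
    entry∈ (just r) A F eq with r ∈? F
    entry∈ (just r) A F () | yes _
    ... | no _ = first-just eq
    entry∈ nothing A F eq = first-just eq

    entry-private : ∀ {A x F} r → (∀ {s} → r ≡ just s → s ∈ A) → x ∈ A → x ∈ F →
      (∀ {y} → y ∈ A → y ∈ F → y ≡ x) → r ≡ just x ⊎ entry r A F ≡ just x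
    entry-private {A} {x} {F} (just r) r∈A x∈A x∈F only-x with r ∈? F
    ... | yes r∈F = inj₁ (cong just (only-x (r∈A refl) r∈F))
    ... | no _ = inj₂ (first-only-x (first-nonempty (x , x∈p∩q⁺ (x∈A , x∈F))))
      where
      first-only-x : (∃ λ y → first (A ∩ F) ≡ just y) → first (A ∩ F) ≡ just x
      first-only-x (y , eq) = let y∈A , y∈F = x∈p∩q⁻ A F (first-just eq) in trans eq (cong just (only-x y∈A y∈F))
    entry-private {A} {x} {F} nothing _ x∈A x∈F only-x with y , eq ← first-nonempty (x , x∈p∩q⁺ (x∈A , x∈F))
      = inj₂ (let y∈A , y∈F = x∈p∩q⁻ A F (first-just eq) in trans eq (cong just (only-x y∈A y∈F)))

    decode-code : ∀ {A} → IsMinCover 𝓕 A → decode (code A) ≡ A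
    decode-code {A} minCover = ⊆-antisym decoded⊆A A⊆decoded
      where
      r : Maybe (Fin n)
      r = first (A ∩ shared)
      r∈A : ∀ {s} → r ≡ just s → s ∈ A
      r∈A eq = proj₁ (x∈p∩q⁻ A shared (first-just eq))
      decoded⊆A : decode (code A) ⊆ A
      decoded⊆A x∈ with ∈-subsetOf⁻ (decodes? (code A)) x∈
      ... | inj₁ r≡x = r∈A r≡x
      ... | inj₂ x∈es with F , _ , entry≡x ← ∈-map⁻ (entry r A) x∈es = proj₁ (x∈p∩q⁻ A F (entry∈ r A F (sym entry≡x)))
      A⊆decoded : A ⊆ decode (code A)
      A⊆decoded x∈A with F , F∈ , x∈F , only-x ← minCover-private minCover x∈A with entry-private r r∈A x∈A x∈F only-x
      ... | inj₁ r≡x = ∈-subsetOf⁺ (decodes? (code A)) (inj₁ r≡x)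
      ... | inj₂ entry≡x = ∈-subsetOf⁺ (decodes? (code A)) (inj₂ (subst (_∈ₗ map (entry r A) Fs) entry≡x (∈-map⁺ (entry r A) F∈)))

    code-injective : ∀ {A B} → IsMinCover 𝓕 A → IsMinCover 𝓕 B → code A ≡ code B → A ≡ B
    code-injective {A} {B} minA minB codeA≡codeB = begin
      A                 ≡⟨ decode-code minA ⟨
      decode (code A)   ≡⟨ cong decode codeA≡codeB ⟩
      decode (code B)   ≡⟨ decode-code minB ⟩
      B                 ∎
      where open ≡-Reasoning

    slot : Fin n → Subset n → List (Maybe (Fin n))
    slot r F with r ∈? F
    ... | yes _ = [ nothing ]
    ... | no _ = map just (allFin n)

    privateChoices : Subset n → List (Maybe (Fin n))
    privateChoices F = map just (elements (privatePart F))

    privateCodes : List Code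
    privateCodes = map (nothing ,′_) (choices (map privateChoices Fs))

    sharedCodes : Fin n → List Code
    sharedCodes r = map (just r ,′_) (choices (map (slot r) Fs))

    codes : List Code
    codes = privateCodes ++ concatMap sharedCodes (elements shared)

    entry∈slot : ∀ r A F → Nonempty (A ∩ F) → entry (just r) A F ∈ₗ slot r F
    entry∈slot r A F A∩F≠∅ with r ∈? F
    ... | yes _ = here refl
    ... | no _ with y , eq ← first-nonempty A∩F≠∅ = subst (_∈ₗ map just (allFin n)) (sym eq) (∈-map⁺ just (∈-allFin y))

    code∈codes : ∀ {A} → IsMinCover 𝓕 A → code A ∈ₗ codes
    code∈codes {A} (cover , _) with first (A ∩ shared) in eq
    ... | nothing = ∈-++⁺ˡ (∈-map⁺ (nothing ,′_) (∈-choices⁺ Fs (entry nothing A) privateChoices entry∈private))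
      where
      entry∈private : ∀ {F} → F ∈ₗ Fs → first (A ∩ F) ∈ₗ privateChoices F
      entry∈private {F} F∈ with y , first≡y ← first-nonempty (cover F F∈) =
        subst (_∈ₗ privateChoices F) (sym first≡y) (∈-map⁺ just (∈-elements⁺ y∈private))
        where
        y∈A : y ∈ A
        y∈A = proj₁ (x∈p∩q⁻ A F (first-just first≡y))
        y∈F : y ∈ F
        y∈F = proj₂ (x∈p∩q⁻ A F (first-just first≡y))
        degree<2 : degree y < 2
        degree<2 = ≰⇒> λ 2≤degree → first-nothing eq (y , x∈p∩q⁺ (y∈A , ∈-subsetOf⁺ (λ x → 2 ≤? degree x) 2≤degree))
        y∈private : y ∈ privatePart F
        y∈private = ∈-subsetOf⁺ (λ x → x ∈? F ×-dec degree x ≟ 1) (y∈F , ≤-antisym (s≤s⁻¹ degree<2) (1≤degree F∈ y∈F))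
    ... | just r = ∈-++⁺ʳ privateCodes (∈-concatMap⁺ sharedCodes (Any.map (λ { refl → r-code∈ }) (∈-elements⁺ r∈shared)))
      where
      r∈shared : r ∈ shared
      r∈shared = proj₂ (x∈p∩q⁻ A shared (first-just eq))
      r-code∈ : (just r , map (entry (just r) A) Fs) ∈ₗ sharedCodes r
      r-code∈ = ∈-map⁺ (just r ,′_) (∈-choices⁺ Fs (entry (just r) A) (slot r) (λ {F} F∈ → entry∈slot r A F (cover F F∈)))

    length-privateCodes : length privateCodes ≡ product privateSizes
    length-privateCodes = begin
      length privateCodes                          ≡⟨ length-map (nothing ,′_) (choices (map privateChoices Fs)) ⟩
      length (choices (map privateChoices Fs))     ≡⟨ length-choices (map privateChoices Fs) ⟩
      product (map length (map privateChoices Fs)) ≡⟨ cong product (map-∘ Fs) ⟨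
      product (map (λ F → length (privateChoices F)) Fs)
        ≡⟨ cong product (map-cong (λ F → trans (length-map just (elements (privatePart F))) (length-elements (privatePart F))) Fs) ⟩
      product (map (λ F → ∣ privatePart F ∣) Fs)   ≡⟨ cong product (map-∘ Fs) ⟩
      product privateSizes                         ∎
      where open ≡-Reasoning

    -- Each member containing r offers one slot, every other member at most n.
    product-slots≤ : ∀ r Gs → product (map length (map (slot r) Gs)) ≤ n ^ (length Gs ∸ length (filter (r ∈?_) Gs))
    product-slots≤ r [] = ≤-refl
    product-slots≤ r (G ∷ Gs) with r ∈? G
    ... | yes _ = ≤-trans (≤-reflexive (*-identityˡ _)) (product-slots≤ r Gs)
    ... | no _ = begin
      length (map just (allFin n)) * product (map length (map (slot r) Gs))
        ≡⟨ cong (_* product (map length (map (slot r) Gs))) (trans (length-map just (allFin n)) (length-tabulate {n = n} (λ x → x))) ⟩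
      n * product (map length (map (slot r) Gs))                              ≤⟨ *-monoʳ-≤ n (product-slots≤ r Gs) ⟩
      n * n ^ (length Gs ∸ length (filter (r ∈?_) Gs))                        ≡⟨ cong (n ^_) (+-∸-assoc 1 (length-filter (r ∈?_) Gs)) ⟨
      n ^ (suc (length Gs) ∸ length (filter (r ∈?_) Gs))                      ∎
      where open ≤-Reasoning

    length-sharedCodes≤ : ∀ {k} → size 𝓕 ≡ suc k → ∀ {r} → r ∈ shared → length (sharedCodes r) ≤ n ^ (k ∸ 1)
    length-sharedCodes≤ {k} size≡ {r} r∈shared = begin
      length (sharedCodes r)                      ≡⟨ length-map (just r ,′_) (choices (map (slot r) Fs)) ⟩
      length (choices (map (slot r) Fs))          ≡⟨ length-choices (map (slot r) Fs) ⟩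
      product (map length (map (slot r) Fs))      ≤⟨ product-slots≤ r Fs ⟩
      n ^ (length Fs ∸ degree r)                  ≤⟨ ^-monoʳ-≤ n {{n≢0}} (∸-mono (≤-reflexive size≡) (∈shared⁻ r∈shared)) ⟩
      n ^ (suc k ∸ 2)                             ∎
      where
      open ≤-Reasoning
      n≢0 : NonZero n
      n≢0 = Fin.nonZeroIndex r

    minCoverCount≤ : ∀ {k c} → size 𝓕 ≡ suc k → MCcount 𝓕 c → c ≤ product privateSizes + ∣ shared ∣ * n ^ (k ∸ 1)
    minCoverCount≤ {k} {c} size≡ (L , L! , length≡ , isMinCover) = begin
      c                                     ≡⟨ length≡ ⟨
      length L                              ≡⟨ length-map code L ⟨
      length (map code L)                   ≤⟨ Unique⇒length≤ codes! codes⊆ ⟩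
      length codes                          ≡⟨ length-++ privateCodes ⟩
      length privateCodes + length (concatMap sharedCodes (elements shared))
        ≤⟨ +-mono-≤ (≤-reflexive length-privateCodes)
                    (length-concatMap≤ sharedCodes (elements shared) (λ r∈ → length-sharedCodes≤ size≡ (∈-elements⁻ r∈))) ⟩
      product privateSizes + length (elements shared) * n ^ (k ∸ 1)
        ≡⟨ cong (λ l → product privateSizes + l * n ^ (k ∸ 1)) (length-elements shared) ⟩
      product privateSizes + ∣ shared ∣ * n ^ (k ∸ 1) ∎
      where
      open ≤-Reasoning
      codes! : Unique (map code L)
      codes! = map-Unique code L! (λ A∈ B∈ → code-injective (proj₁ (isMinCover _) A∈) (proj₁ (isMinCover _) B∈))
      codes⊆ : ∀ {c} → c ∈ₗ map code L → c ∈ₗ codes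
      codes⊆ c∈ with A , A∈ , refl ← ∈-map⁻ code c∈ = code∈codes (proj₁ (isMinCover A) A∈)

    isBalancedPartition : sum privateSizes ≡ n → Balanced privateSizes → 1 ≤ product privateSizes → IsBalancedPartition 𝓕
    isBalancedPartition sum≡n balanced 1≤Π = nonempty , disjoint , covered , sizes
      where
      degree≡1 : ∀ x → degree x ≡ 1
      degree≡1 = sum-privateSizes≡n⇒degree≡1 sum≡n
      privatePart≡ : ∀ F → privatePart F ≡ F
      privatePart≡ = degree≡1⇒privatePart≡ degree≡1
      size∈ : ∀ {F} → F ∈ₗ Fs → ∣ F ∣ ∈ₗ privateSizes
      size∈ {F} F∈ = subst (_∈ₗ privateSizes) (cong ∣_∣ (privatePart≡ F)) (∈-map⁺ ∣_∣ (∈-map⁺ privatePart F∈))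
      nonempty : ∀ F → F ∈ₗ Fs → Nonempty F
      nonempty F F∈ = 1≤∣p∣⇒Nonempty F (1≤product⇒1≤∈ 1≤Π (size∈ F∈))
      disjoint : ∀ F G → F ∈ₗ Fs → G ∈ₗ Fs → F ≢ G → Empty (F ∩ G)
      disjoint F G F∈ G∈ F≢G (x , x∈) =
        let x∈F , x∈G = x∈p∩q⁻ F G x∈ in <-irrefl (sym (degree≡1 x)) (2≤degree F∈ G∈ F≢G x∈F x∈G)
      covered : ∀ x → Σ (Subset n) λ F → F ∈ₗ Fs × x ∈ F
      covered x = degree≡1⇒covered (degree≡1 x)
      sizes : ∀ F G → F ∈ₗ Fs → G ∈ₗ Fs → ∣ F ∣ ≤ suc ∣ G ∣
      sizes F G F∈ G∈ = balanced (size∈ F∈) (size∈ G∈)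

    -- In a partition the minimal covers are exactly the transversals.
    module Partition (degree≡1 : ∀ x → degree x ≡ 1) where

      ∉shared : ∀ {x} → x ∉ shared
      ∉shared {x} x∈ = <-irrefl (sym (degree≡1 x)) (∈shared⁻ x∈)

      module Transversal (pick : Subset n → Maybe (Fin n)) (pick∈ : ∀ {F} → F ∈ₗ Fs → pick F ∈ₗ privateChoices F) where

        T : Subset n
        T = decode (nothing , map pick Fs)

        pick∈F : ∀ {F} → F ∈ₗ Fs → ∃ λ y → pick F ≡ just y × y ∈ F
        pick∈F {F} F∈ with y , y∈ , pickF≡y ← ∈-map⁻ just (pick∈ F∈) = y , pickF≡y , proj₁ (∈privatePart⁻ (∈-elements⁻ y∈))

        ∈T⁺ : ∀ {F y} → F ∈ₗ Fs → pick F ≡ just y → y ∈ T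
        ∈T⁺ {F} F∈ pickF≡y = ∈-subsetOf⁺ (decodes? (nothing , map pick Fs)) (inj₂ (subst (_∈ₗ map pick Fs) pickF≡y (∈-map⁺ pick F∈)))

        ∈T⁻ : ∀ {x} → x ∈ T → ∃ λ G → G ∈ₗ Fs × pick G ≡ just x × x ∈ G
        ∈T⁻ x∈T with ∈-subsetOf⁻ (decodes? (nothing , map pick Fs)) x∈T
        ... | inj₁ ()
        ... | inj₂ x∈es with G , G∈ , x≡pickG ← ∈-map⁻ pick x∈es with y , pickG≡y , y∈G ← pick∈F G∈ =
          G , G∈ , sym x≡pickG , subst (_∈ G) (Maybe.just-injective (trans (sym pickG≡y) (sym x≡pickG))) y∈G

        T∩F : ∀ {F z} → F ∈ₗ Fs → z ∈ T → z ∈ F → pick F ≡ just z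
        T∩F {F} {z} F∈ z∈T z∈F with G , G∈ , pickG≡z , z∈G ← ∈T⁻ z∈T =
          trans (cong pick (degree≡1⇒unique (degree≡1 z) F∈ G∈ z∈F z∈G)) pickG≡z

        T-minCover : IsMinCover 𝓕 T
        T-minCover = cover , minimal
          where
          cover : IsCover 𝓕 T
          cover F F∈ with y , pickF≡y , y∈F ← pick∈F F∈ = y , x∈p∩q⁺ (∈T⁺ F∈ pickF≡y , y∈F)
          minimal : ∀ B → B ⊂ T → ¬ IsCover 𝓕 B
          minimal B (B⊆T , x , x∈T , x∉B) B-cover
            with G , G∈ , pickG≡x , x∈G ← ∈T⁻ x∈T
            with z , z∈B∩G ← B-cover G G∈
            with z∈B , z∈G ← x∈p∩q⁻ B G z∈B∩G
            = x∉B (subst (_∈ B) (Maybe.just-injective (trans (sym (T∩F G∈ (B⊆T z∈B) z∈G)) pickG≡x)) z∈B)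

        code-T : code T ≡ (nothing , map pick Fs)
        code-T = begin
          code T                               ≡⟨ cong (λ r → r , map (entry r T) Fs) first≡nothing ⟩
          (nothing , map (entry nothing T) Fs) ≡⟨ cong (nothing ,_) (map-cong-local (All.tabulate entry≡pick)) ⟩
          (nothing , map pick Fs)                 ∎
          where
          open ≡-Reasoning
          first≡nothing : first (T ∩ shared) ≡ nothing
          first≡nothing with first (T ∩ shared) in eq
          ... | nothing = refl
          ... | just r = ⊥-elim (∉shared (proj₂ (x∈p∩q⁻ T shared (first-just eq))))
          entry≡pick : ∀ {F} → F ∈ₗ Fs → first (T ∩ F) ≡ pick F
          entry≡pick {F} F∈ with y , pickF≡y , y∈F ← pick∈F F∈ with z , first≡z ← first-nonempty (y , x∈p∩q⁺ (∈T⁺ F∈ pickF≡y , y∈F)) =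
            let z∈T , z∈F = x∈p∩q⁻ T F (first-just first≡z) in trans first≡z (sym (T∩F F∈ z∈T z∈F))

      privateCode⇒transversal : ∀ {c} → c ∈ₗ privateCodes →
        ∃ λ pick → (∀ {F} → F ∈ₗ Fs → pick F ∈ₗ privateChoices F) × c ≡ (nothing , map pick Fs)
      privateCode⇒transversal c∈
        with es , es∈ , refl ← ∈-map⁻ (nothing ,′_) c∈
        with pick , refl , pick∈ ← ∈-choices⁻ nothing _≟ˢ_ privateChoices (unique 𝓕) es∈
        = pick , pick∈ , refl

      decode-minCover : ∀ {c} → c ∈ₗ privateCodes → IsMinCover 𝓕 (decode c)
      decode-minCover c∈ with pick , pick∈ , refl ← privateCode⇒transversal c∈ = Transversal.T-minCover pick pick∈

      code-decode : ∀ {c} → c ∈ₗ privateCodes → code (decode c) ≡ c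
      code-decode c∈ with pick , pick∈ , refl ← privateCode⇒transversal c∈ = Transversal.code-T pick pick∈

      privateCodes-Unique : Unique privateCodes
      privateCodes-Unique = Unique.map⁺ (cong proj₂)
        (choices-Unique (All.map⁺ {xs = Fs} (All.tabulate λ {F} _ → Unique.map⁺ Maybe.just-injective (elements-Unique (privatePart F)))))

      minCoverCount : MCcount 𝓕 (product (map ∣_∣ Fs))
      minCoverCount = map decode privateCodes , transversals-Unique , length≡ , λ A → decoded⇒minCover , minCover⇒decoded
        where
        transversals-Unique : Unique (map decode privateCodes)
        transversals-Unique = map-Unique decode privateCodes-Unique λ c∈ d∈ decode≡ →
          trans (sym (code-decode c∈)) (trans (cong code decode≡) (code-decode d∈))
        length≡ : length (map decode privateCodes) ≡ product (map ∣_∣ Fs)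
        length≡ = begin
          length (map decode privateCodes)   ≡⟨ length-map decode privateCodes ⟩
          length privateCodes                ≡⟨ length-privateCodes ⟩
          product (map ∣_∣ (map privatePart Fs))
            ≡⟨ cong (λ Gs → product (map ∣_∣ Gs)) (trans (map-cong (degree≡1⇒privatePart≡ degree≡1) Fs) (map-id Fs)) ⟩
          product (map ∣_∣ Fs)               ∎
          where open ≡-Reasoning
        decoded⇒minCover : ∀ {A} → A ∈ₗ map decode privateCodes → IsMinCover 𝓕 A
        decoded⇒minCover A∈ with c , c∈ , refl ← ∈-map⁻ decode A∈ = decode-minCover c∈
        minCover⇒decoded : ∀ {A} → IsMinCover 𝓕 A → A ∈ₗ map decode privateCodes
        minCover⇒decoded minCover with ∈-++⁻ privateCodes (code∈codes minCover)
        ... | inj₁ code∈ = subst (_∈ₗ map decode privateCodes) (decode-code minCover) (∈-map⁺ decode code∈)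
        ... | inj₂ code∈ with r , r∈ , _ ← find (∈-concatMap⁻ sharedCodes code∈) = ⊥-elim (∉shared (∈-elements⁻ r∈))

module BalancedPartition where

  open import Data.Nat
  open import Data.Nat.Properties
  open import Data.Nat.ListAction using (sum; product)
  open import Data.Fin using (Fin; zero; suc)
  import Data.Fin.Properties as Fin
  open import Data.Fin.Subset using (Subset; _∈_; ⋃; ⊤; ∣_∣; Nonempty)
  open import Data.Fin.Subset.Properties using (⊆-antisym; ⊆⊤; ∣⊤∣≡n; x∈p∩q⁻)
  open import Data.List using (List; []; _∷_; length; map; allFin)
  open import Data.List.Properties using (length-map; length-tabulate)
  open import Data.List.Membership.Propositional using () renaming (_∈_ to _∈ₗ_)
  open import Data.List.Membership.Propositional.Properties using (∈-map⁺; ∈-map⁻; ∈-allFin)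
  open import Data.List.Relation.Unary.Any as Any using (here; there)
  import Data.List.Relation.Unary.Any.Properties as Any
  import Data.List.Relation.Unary.All as All
  import Data.List.Relation.Unary.Unique.Propositional.Properties as Unique
  open import Data.List.Extrema.Nat using (argmin; f[argmin]≤f[xs])
  open import Data.Product using (Σ; ∃; _×_; _,_; proj₁; proj₂)
  open import Data.Sum using (_⊎_; inj₁; inj₂)
  open import Data.Empty using (⊥-elim)
  open import Relation.Nullary using (yes; no)
  open import Relation.Binary.PropositionalEquality
  open import Defs using (Family; family; size; MCcount)
  open FloorProduct using (balancedProduct; balancedProduct-pos)
  open ProductBound using (Balanced; twoValued⇒Balanced; product-balanced; 1≤product⇒1≤∈)
  open Lists using (map-AllPairs)
  open FinSubsets
  open MinimalCovers using (degree; unique⇒degree≡1; module Partition)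

  fibre : ∀ {n m} → (Fin n → Fin m) → Fin m → Subset n
  fibre f i = subsetOf (λ x → f x Fin.≟ i)

  record BalancedColouring (n m : ℕ) : Set where
    field
      colour     : Fin n → Fin m
      q          : ℕ
      fibre-size : ∀ i → ∣ fibre colour i ∣ ≡ q ⊎ ∣ fibre colour i ∣ ≡ suc q

  extend : ∀ {n m} (C : BalancedColouring n m) (i₀ : Fin m) →
    (∀ i → ∣ fibre (BalancedColouring.colour C) i₀ ∣ ≤ ∣ fibre (BalancedColouring.colour C) i ∣) →
    BalancedColouring (suc n) m
  extend {n} {m} C i₀ i₀-min = record { colour = colour′ ; q = q′ ; fibre-size = fibre-size′ }
    where
    open BalancedColouring C
    colour′ : Fin (suc n) → Fin m
    colour′ zero = i₀
    colour′ (suc x) = colour x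
    q′ : ℕ
    q′ with fibre-size i₀
    ... | inj₁ _ = q
    ... | inj₂ _ = suc q
    fibre-size′ : ∀ i → ∣ fibre colour′ i ∣ ≡ q′ ⊎ ∣ fibre colour′ i ∣ ≡ suc q′
    fibre-size′ i with fibre-size i₀ | i₀ Fin.≟ i
    ... | inj₁ size≡q | yes refl = inj₂ (cong suc size≡q)
    ... | inj₁ _ | no _ = fibre-size i
    ... | inj₂ size≡1+q | yes refl = inj₂ (cong suc size≡1+q)
    ... | inj₂ size₀≡1+q | no _ with fibre-size i
    ...   | inj₁ size≡q = ⊥-elim (<-irrefl refl (≤-trans (≤-reflexive (trans (cong suc size≡q) (sym size₀≡1+q))) (i₀-min i)))
    ...   | inj₂ size≡1+q = inj₁ size≡1+q

  balancedColouring : ∀ k n → BalancedColouring n (suc k)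
  balancedColouring k zero = record { colour = λ () ; q = 0 ; fibre-size = λ _ → inj₁ refl }
  balancedColouring k (suc n) = extend C (argmin fibreSize zero (allFin (suc k)))
    (λ i → All.lookup (f[argmin]≤f[xs] {f = fibreSize} zero (allFin (suc k))) (∈-allFin i))
    where
    C : BalancedColouring n (suc k)
    C = balancedColouring k n
    fibreSize : Fin (suc k) → ℕ
    fibreSize i = ∣ fibre (BalancedColouring.colour C) i ∣

  module _ (k n : ℕ) (m≤n : suc k ≤ n) where

    private
      open BalancedColouring (balancedColouring k n)

      parts : List (Subset n)
      parts = map (fibre colour) (allFin (suc k))

      sizes : List ℕ
      sizes = map ∣_∣ parts

      ∈fibre⁻ : ∀ {x} i → x ∈ fibre colour i → colour x ≡ i
      ∈fibre⁻ i = ∈-subsetOf⁻ (λ x → colour x Fin.≟ i)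

      ∈fibre⁺ : ∀ x → x ∈ fibre colour (colour x)
      ∈fibre⁺ x = ∈-subsetOf⁺ (λ y → colour y Fin.≟ colour x) refl

      fibre∈parts : ∀ i → fibre colour i ∈ₗ parts
      fibre∈parts i = ∈-map⁺ (fibre colour) (∈-allFin i)

      ∈sizes⁻ : ∀ {z} → z ∈ₗ sizes → ∃ λ i → z ≡ ∣ fibre colour i ∣
      ∈sizes⁻ z∈ with G , G∈ , z≡ ← ∈-map⁻ ∣_∣ z∈ with i , _ , G≡ ← ∈-map⁻ (fibre colour) G∈ =
        i , trans z≡ (cong ∣_∣ G≡)

      sizes-balanced : Balanced sizes
      sizes-balanced = twoValued⇒Balanced λ z∈ →
        let i , z≡ = ∈sizes⁻ z∈ in subst (λ z → z ≡ q ⊎ z ≡ suc q) (sym z≡) (fibre-size i)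

      length-sizes : length sizes ≡ suc k
      length-sizes = trans (length-map ∣_∣ parts) (trans (length-map (fibre colour) (allFin (suc k))) (length-tabulate {n = suc k} (λ i → i)))

      sum-sizes : sum sizes ≡ n
      sum-sizes = begin
        sum sizes      ≡⟨ sum-∣∣≡∣⋃∣ (map-AllPairs (fibre colour) (Unique.allFin⁺ (suc k)) disjoint) ⟩
        ∣ ⋃ parts ∣    ≡⟨ cong ∣_∣ ⋃parts≡⊤ ⟩
        ∣ ⊤ {n} ∣      ≡⟨ ∣⊤∣≡n n ⟩
        n              ∎
        where
        open ≡-Reasoning
        disjoint : ∀ {i j} → i ∈ₗ allFin (suc k) → j ∈ₗ allFin (suc k) → i ≢ j → Disjoint (fibre colour i) (fibre colour j)
        disjoint {i} {j} _ _ i≢j (x , x∈) =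
          let x∈i , x∈j = x∈p∩q⁻ (fibre colour i) (fibre colour j) x∈ in i≢j (trans (sym (∈fibre⁻ i x∈i)) (∈fibre⁻ j x∈j))
        ⋃parts≡⊤ : ⋃ parts ≡ ⊤ {n}
        ⋃parts≡⊤ = ⊆-antisym ⊆⊤ λ {x} _ → ∈⋃⁺ (Any.map (λ { refl → ∈fibre⁺ x }) (fibre∈parts (colour x)))

      product-sizes : product sizes ≡ balancedProduct k n
      product-sizes = trans (product-balanced k sizes length-sizes sizes-balanced) (cong (balancedProduct k) sum-sizes)

      1≤product-sizes : 1 ≤ product sizes
      1≤product-sizes = ≤-trans (balancedProduct-pos k m≤n) (≤-reflexive (sym product-sizes))

      fibre-nonempty : ∀ i → Nonempty (fibre colour i)
      fibre-nonempty i =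
        1≤∣p∣⇒Nonempty (fibre colour i) (1≤product⇒1≤∈ {xs = sizes} 1≤product-sizes (∈-map⁺ ∣_∣ (fibre∈parts i)))

      fibre-injective : ∀ {i j} → fibre colour i ≡ fibre colour j → i ≡ j
      fibre-injective {i} {j} fibre≡ = trans (sym (∈fibre⁻ i x∈i)) (∈fibre⁻ j (subst (x ∈_) fibre≡ x∈i))
        where
        x : Fin n
        x = proj₁ (fibre-nonempty i)
        x∈i : x ∈ fibre colour i
        x∈i = proj₂ (fibre-nonempty i)

      partition : Family n
      partition = family parts (Unique.map⁺ fibre-injective (Unique.allFin⁺ (suc k)))

      partition-degree≡1 : ∀ x → degree partition x ≡ 1
      partition-degree≡1 x = unique⇒degree≡1 partition (fibre∈parts (colour x)) (∈fibre⁺ x) same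
        where
        same : ∀ {G H} → G ∈ₗ parts → H ∈ₗ parts → x ∈ G → x ∈ H → G ≡ H
        same G∈ H∈ x∈G x∈H
          with i , _ , refl ← ∈-map⁻ (fibre colour) G∈ | j , _ , refl ← ∈-map⁻ (fibre colour) H∈
          = cong (fibre colour) (trans (sym (∈fibre⁻ i x∈G)) (∈fibre⁻ j x∈H))

    balancedPartition : Σ (Family n) λ 𝓕 → size 𝓕 ≡ suc k × MCcount 𝓕 (balancedProduct k n)
    balancedPartition = partition , trans (sym (length-map ∣_∣ parts)) length-sizes ,
      subst (MCcount partition) product-sizes (Partition.minCoverCount partition partition-degree≡1)

open import Defs

module UpperBound where

  open import Data.Nat
  open import Data.Nat.Properties
  open import Data.Fin.Subset using (∣_∣)
  open import Data.List using (length; map)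
  open import Data.List.Properties using (length-map)
  open import Data.Product using (_,_)
  open import Relation.Binary.PropositionalEquality
  open FloorProduct using (balancedProduct)
  open Deficit using (threshold; module Excess)
  open MinimalCovers

  module _ (k : ℕ) {n : ℕ} (n₀≤n : threshold k ≤ n) (𝓕 : Family n) (size≡ : size 𝓕 ≡ suc k) where

    private
      length-privateSizes : length (privateSizes 𝓕) ≡ suc k
      length-privateSizes = trans (length-map ∣_∣ (map (privatePart 𝓕) (sets 𝓕)))
        (trans (length-map (privatePart 𝓕) (sets 𝓕)) size≡)

      k≡0⇒∣shared∣≡0 : k ≡ 0 → ∣ shared 𝓕 ∣ ≡ 0
      k≡0⇒∣shared∣≡0 refl = size≡1⇒∣shared∣≡0 𝓕 size≡

      open Excess k (privateSizes 𝓕) n₀≤n length-privateSizes (sum-privateSizes+∣shared∣≤n 𝓕) k≡0⇒∣shared∣≡0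

    minCoverCount≤balancedProduct : ∀ {c} → MCcount 𝓕 c → c ≤ balancedProduct k n
    minCoverCount≤balancedProduct count = ≤-trans (minCoverCount≤ 𝓕 size≡ count) excess≤balancedProduct

    extremal⇒balancedPartition : MCcount 𝓕 (balancedProduct k n) → IsBalancedPartition 𝓕
    extremal⇒balancedPartition count with _ , sum≡n , balanced , 1≤Π ← excess≡balancedProduct⇒
      (≤-antisym excess≤balancedProduct (minCoverCount≤ 𝓕 size≡ count))
      = isBalancedPartition 𝓕 sum≡n balanced 1≤Π

open import Data.Nat using (ℕ; suc; _≤_; _^_; NonZero) renaming (_*_ to _*ℕ_)
import Data.Nat.Properties as ℕ
open import Data.Product using (Σ; _×_; _,_)
open import Relation.Binary.PropositionalEquality using (_≡_)
open import Data.Rational using (ℚ; Positive; ∣_∣; _-_; _*_) renaming (_≤_ to _≤ℚ_)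
open UpperBound
open Deficit using (threshold; suc≤threshold)
open BalancedPartition using (balancedPartition)
open RelativeError using (relative-error)

proposition1p4 : ∀ (m : ℕ) → .{{_ : NonZero m}} →
    (Σ ℕ λ n₀ → ∀ (n : ℕ) → n₀ ≤ n →
      IsG n m (floorProd n m m) ×
      (∀ (𝓕 : Family n) → size 𝓕 ≡ m → MCcount 𝓕 (floorProd n m m) →
        IsBalancedPartition 𝓕)) ×
    (∀ (ε : ℚ) → Positive ε → Σ ℕ λ N → ∀ (n : ℕ) → N ≤ n →
      ∣ ℕ→ℚ (floorProd n m m *ℕ m ^ m) - ℕ→ℚ (n ^ m) ∣ ≤ℚ ε * ℕ→ℚ (n ^ m))
proposition1p4 (suc k) = (threshold k , large-n) , relative-error k
  where
  large-n : ∀ n → threshold k ≤ n →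
    IsG n (suc k) (floorProd n (suc k) (suc k)) ×
    (∀ (𝓕 : Family n) → size 𝓕 ≡ suc k → MCcount 𝓕 (floorProd n (suc k) (suc k)) → IsBalancedPartition 𝓕)
  large-n n n₀≤n =
    ( (λ 𝓕 size≡ _ count → minCoverCount≤balancedProduct k n₀≤n 𝓕 size≡ count)
    , balancedPartition k n (ℕ.≤-trans (suc≤threshold k) n₀≤n) )
    , λ 𝓕 size≡ count → extremal⇒balancedPartition k n₀≤n 𝓕 size≡ count
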